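{- Let $k\ge 1$ and let $S_1,\ldots,S_k$ be nonempty finite strings of positive integers such that no $S_i$ occurs as a substring (consecutive block) of any $S_j$ with $j\neq i$. Let $$G(x,q)=\sum_{\sigma} x^{w(\sigma)}q^{\ell(\sigma)},$$ where the sum runs over all compositions $\sigma$ (including the empty composition, which contributes $1$) with parts in $\mathbb{N}=\{1,2,3,\ldots\}$ that contain none of $S_1,\ldots,S_k$ as a substring. Then $$G(x,q)=\frac{(1-x)\cdot\det\big(-c_{ij}(x,q)\big)_{1\le i,j\le k}}{\det M},$$ where $M$ is the $(k+1)\times(k+1)$ matrix whose first row is $\big(1-x(1+q),\,1-x,\,1-x,\,\ldots,\,1-x\big)$ and whose row $i+1$ (for $i=1,\ldots,k$) is $\big(x^{w(S_i)}q^{\ell(S_i)},\,-c_{i1}(x,q),\,\ldots,\,-c_{ik}(x,q)\big)$.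
   Context: A composition $\sigma=\sigma_1\cdots\sigma_m$ is a finite string of positive integers; its weight is $w(\sigma)=\sigma_1+\cdots+\sigma_m$ and its length (number of parts) is $\ell(\sigma)=m$. The same notation $w$, $\ell$ is used for any finite string of positive integers. A string $s_1\cdots s_m$ contains the substring $b_1\cdots b_r$ if there is $i$ with $s_is_{i+1}\cdots s_{i+r-1}=b_1\cdots b_r$; otherwise it avoids it. Correlation: for strings $S_i=a_0a_1\cdots a_{m-1}$ and $S_j=b_0b_1\cdots b_{\ell-1}$, the correlation is the binary string $c_0c_1\cdots c_{m-1}$ defined by: if $m\le \ell$, for $0\le t\le m-1$, $c_t=1$ iff $a_r=b_{\ell-m+r+t}$ for all $r=0,\ldots,m-t-1$, and $c_t=0$ otherwise; if $m>\ell$, for $0\le t\le m-\ell$, $c_t=1$ iff $b_r=a_{m-\ell+r-t}$ for all $r=0,\ldots,\ell-1$, and for $m-\ell+1\le t\le m-1$, $c_t=1$ iff $a_r=b_{\ell-m+r+t}$ for all $r=0,\ldots,m-t-1$; $c_t=0$ otherwise. The correlation polynomial is $$c_{ij}(x,q)=c_0+c_1x^{a_{m-1}}q+c_2x^{a_{m-2}+a_{m-1}}q^2+\cdots+c_{m-1}x^{a_1+a_2+\cdots+a_{m-1}}q^{m-1},$$ i.e. the term for $t$ is $c_t\,x^{a_{m-t}+\cdots+a_{m-1}}q^t$. -}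

module Defs where

open import Data.Nat as ℕ using (ℕ; zero; suc; _∸_; _≤?_)
open import Data.Nat.Properties using () renaming (_≟_ to _≟ℕ_)
open import Data.Integer as ℤ using (ℤ; +_; 0ℤ; 1ℤ)
open import Data.Fin using (Fin; zero; suc; toℕ; punchIn)
open import Data.Nat.ListAction using (sum)
open import Data.List using (List; []; _∷_; length; take; drop; filter; concatMap; map; upTo)
open import Data.List.Relation.Unary.All using (All)
open import Data.List.Relation.Binary.Infix.Heterogeneous using (Infix)
open import Data.List.Relation.Binary.Infix.Heterogeneous.Properties using (infix?)
open import Data.List.Properties using (≡-dec)
open import Data.Bool using (Bool; true; false; if_then_else_)
open import Relation.Nullary using (Dec; yes; no; does; ¬?)
open import Relation.Nullary.Decidable using (_×-dec_)
open import Relation.Binary.PropositionalEquality using (_≡_)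

_occursIn_ : List ℕ → List ℕ → Set
t occursIn s = Infix _≡_ t s

_occursIn?_ : (t s : List ℕ) → Dec (t occursIn s)
t occursIn? s = infix? _≟ℕ_ t s

avoidsAll? : ∀ {k} → (Fin k → List ℕ) → (s : List ℕ) → Bool
avoidsAll? {zero}  S s = true
avoidsAll? {suc k} S s =
  if does (S zero occursIn? s) then false else avoidsAll? (λ i → S (suc i)) s

-- Formal power series in x, q with integer coefficients:
-- F n m is the coefficient of x^n q^m.

PS : Set
PS = ℕ → ℕ → ℤ

_≈PS_ : PS → PS → Set
F ≈PS G = ∀ n m → F n m ≡ G n m

sumTo : ℕ → (ℕ → ℤ) → ℤ
sumTo zero    f = f 0
sumTo (suc n) f = sumTo n f ℤ.+ f (suc n)

0PS : PS
0PS _ _ = 0ℤ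

mono : ℤ → ℕ → ℕ → PS
mono c a b n m with does (n ≟ℕ a ×-dec m ≟ℕ b)
... | true  = c
... | false = 0ℤ

1PS : PS
1PS = mono 1ℤ 0 0

xPS : PS
xPS = mono 1ℤ 1 0

qPS : PS
qPS = mono 1ℤ 0 1

_+PS_ : PS → PS → PS
(F +PS G) n m = F n m ℤ.+ G n m

-PS_ : PS → PS
(-PS F) n m = ℤ.- F n m

_-PS_ : PS → PS → PS
F -PS G = F +PS (-PS G)

_*PS_ : PS → PS → PS
(F *PS G) n m = sumTo n λ a → sumTo m λ b → F a b ℤ.* G (n ∸ a) (m ∸ b)

infixl 6 _+PS_ _-PS_
infixl 7 _*PS_

ΣFin : ∀ {n} → (Fin n → PS) → PS
ΣFin {zero}  f = 0PS
ΣFin {suc n} f = f zero +PS ΣFin (λ j → f (suc j))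

sign : ℕ → PS
sign zero          = 1PS
sign (suc zero)    = -PS 1PS
sign (suc (suc n)) = sign n

det : ∀ {n} → (Fin n → Fin n → PS) → PS
det {zero}  A = 1PS
det {suc n} A =
  ΣFin λ j → sign (toℕ j) *PS A zero j *PS det (λ r c → A (suc r) (punchIn j c))

-- Correlation of S_i = a_0…a_{m-1} and S_j = b_0…b_{ℓ-1}.
-- c_t = 1 iff
--   (m ≤ ℓ, or m > ℓ and t ≥ m-ℓ+1):  a_0…a_{m-t-1} = b_{ℓ-m+t}…b_{ℓ-1}
--   (m > ℓ and t ≤ m-ℓ):             b_0…b_{ℓ-1} = a_{m-ℓ-t}…a_{m-ℓ-t+ℓ-1}
corrBit : List ℕ → List ℕ → ℕ → Bool
corrBit a b t with length a ≤? length b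
... | yes _ = does (≡-dec _≟ℕ_ (take (m ∸ t) a) (drop (ℓ ∸ (m ∸ t)) b))
  where m = length a ; ℓ = length b
... | no _ with t ≤? (length a ∸ length b)
...   | yes _ = does (≡-dec _≟ℕ_ b (take ℓ (drop (m ∸ ℓ ∸ t) a)))
  where m = length a ; ℓ = length b
...   | no _  = does (≡-dec _≟ℕ_ (take (m ∸ t) a) (drop (ℓ ∸ (m ∸ t)) b))
  where m = length a ; ℓ = length b

-- correlation polynomial c(x,q) = Σ_{t=0}^{m-1} c_t x^{a_{m-t}+…+a_{m-1}} q^t
corrPolyFrom : List ℕ → List ℕ → ℕ → ℕ → PS
corrPolyFrom a b t zero    = 0PS
corrPolyFrom a b t (suc r) =
  (if corrBit a b t then mono 1ℤ (sum (drop (length a ∸ t) a)) t else 0PS)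
  +PS corrPolyFrom a b (suc t) r

corrPoly : List ℕ → List ℕ → PS
corrPoly a b = corrPolyFrom a b 0 (length a)

listsOver : ℕ → List ℕ → List (List ℕ)
listsOver zero    xs = [] ∷ []
listsOver (suc m) xs = concatMap (λ a → map (a ∷_) (listsOver m xs)) xs

-- [x^n q^m] G = number of compositions of n with m parts (all parts lie in
-- {1,…,n}) containing none of the S_i as a substring.
Gcoeff : ∀ {k} → (Fin k → List ℕ) → ℕ → ℕ → ℕ
Gcoeff S n m =
  length (filter (λ σ → (sum σ ≟ℕ n) ×-dec (avoidsAll? S σ Data.Bool.≟ true))
                 (listsOver m (map suc (upTo n))))

GPS : ∀ {k} → (Fin k → List ℕ) → PS
GPS S n m = + Gcoeff S n m

negCorrMatrix : ∀ {k} → (Fin k → List ℕ) → Fin k → Fin k → PS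
negCorrMatrix S i j = -PS corrPoly (S i) (S j)

Mmatrix : ∀ {k} → (Fin k → List ℕ) → Fin (suc k) → Fin (suc k) → PS
Mmatrix S zero    zero    = 1PS -PS xPS *PS (1PS +PS qPS)
Mmatrix S zero    (suc j) = 1PS -PS xPS
Mmatrix S (suc i) zero    = mono 1ℤ (sum (S i)) (length (S i))
Mmatrix S (suc i) (suc j) = negCorrMatrix S i j

module Submission where

-- Besides G consider, for each j, the series H_j of the words whose only forbidden factor
-- is an occurrence of S_j at their very end.  Two bijective counting identities give a
-- linear system for (G, H_1, …, H_k):
--  * appending a letter to an avoiding word gives an avoiding word or a word first hit by
--    exactly one S_j, hence  (1 − x(1+q)) G + (1 − x) Σ_j H_j = 1 − x;
--  * cutting a word τ S_i (τ avoiding) just after its first forbidden factor S_j leaves the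
--    last s letters of S_i, where s runs over the overlaps recorded by the correlation
--    c_ij, hence  x^{w(S_i)} q^{ℓ(S_i)} G − Σ_j c_ij H_j = 0.
-- This is  M · (G, H_1, …, H_k) = (1 − x, 0, …, 0), and Cramer's rule for the first unknown
-- gives the theorem.

open import Defs
open import Data.Nat using (ℕ; suc; _≤_; NonZero)
open import Data.Fin using (Fin)
open import Data.List using (List; [])
open import Data.List.Relation.Unary.All using (All)
open import Relation.Nullary using (¬_)
open import Relation.Binary.PropositionalEquality using (_≢_)

module FiniteSums where

  open import Data.Nat as ℕ using (ℕ; zero; suc; _∸_; _≤_; z≤n)
  open import Data.Nat.Properties as ℕP using ()
  open import Data.Integer using (ℤ; 0ℤ; 1ℤ; _+_; _*_; -_)
  open import Data.Fin using (Fin; zero; suc)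
  open import Data.Fin.Properties as FP using ()
  open import Data.Integer.Properties as ℤP using ()
  open import Data.Integer.Tactic.RingSolver using (solve-∀)
  open import Relation.Binary.PropositionalEquality

  sumTo-cong-≤ : ∀ n {f g : ℕ → ℤ} → (∀ a → a ≤ n → f a ≡ g a) → sumTo n f ≡ sumTo n g
  sumTo-cong-≤ zero    eq = eq 0 z≤n
  sumTo-cong-≤ (suc n) eq =
    cong₂ _+_ (sumTo-cong-≤ n (λ a a≤n → eq a (ℕP.m≤n⇒m≤1+n a≤n))) (eq (suc n) ℕP.≤-refl)

  sumTo-cong : ∀ n {f g : ℕ → ℤ} → (∀ a → f a ≡ g a) → sumTo n f ≡ sumTo n g
  sumTo-cong n eq = sumTo-cong-≤ n (λ a _ → eq a)

  sumTo-+ : ∀ n (f g : ℕ → ℤ) → sumTo n (λ a → f a + g a) ≡ sumTo n f + sumTo n g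
  sumTo-+ zero    f g = refl
  sumTo-+ (suc n) f g rewrite sumTo-+ n f g =
    interchange (sumTo n f) (sumTo n g) (f (suc n)) (g (suc n))
    where interchange : ∀ a b c d → (a + b) + (c + d) ≡ (a + c) + (b + d)
          interchange = solve-∀

  sumTo-*ˡ : ∀ n c (f : ℕ → ℤ) → c * sumTo n f ≡ sumTo n (λ a → c * f a)
  sumTo-*ˡ zero    c f = refl
  sumTo-*ˡ (suc n) c f rewrite sym (sumTo-*ˡ n c f) = ℤP.*-distribˡ-+ c (sumTo n f) (f (suc n))

  sumTo-*ʳ : ∀ n c (f : ℕ → ℤ) → sumTo n f * c ≡ sumTo n (λ a → f a * c)
  sumTo-*ʳ n c f =
    trans (ℤP.*-comm (sumTo n f) c)
          (trans (sumTo-*ˡ n c f) (sumTo-cong n (λ a → ℤP.*-comm c (f a))))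

  sumTo-0 : ∀ n {f : ℕ → ℤ} → (∀ a → a ≤ n → f a ≡ 0ℤ) → sumTo n f ≡ 0ℤ
  sumTo-0 zero    eq = eq 0 z≤n
  sumTo-0 (suc n) eq
    rewrite sumTo-0 n (λ a a≤n → eq a (ℕP.m≤n⇒m≤1+n a≤n)) | eq (suc n) ℕP.≤-refl = refl

  sumTo-suc : ∀ n (f : ℕ → ℤ) → sumTo (suc n) f ≡ f 0 + sumTo n (λ a → f (suc a))
  sumTo-suc zero    f = refl
  sumTo-suc (suc n) f rewrite sumTo-suc n f =
    ℤP.+-assoc (f 0) (sumTo n (λ a → f (suc a))) (f (suc (suc n)))

  sumTo-swap : ∀ n m (f : ℕ → ℕ → ℤ) →
    sumTo n (λ a → sumTo m (λ b → f a b)) ≡ sumTo m (λ b → sumTo n (λ a → f a b))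
  sumTo-swap zero    m f = refl
  sumTo-swap (suc n) m f rewrite sumTo-swap n m f =
    sym (sumTo-+ m (λ b → sumTo n (λ a → f a b)) (λ b → f (suc n) b))

  sumTo-reverse : ∀ n (f : ℕ → ℤ) → sumTo n f ≡ sumTo n (λ a → f (n ∸ a))
  sumTo-reverse zero    f = refl
  sumTo-reverse (suc n) f =
    begin
      sumTo n f + f (suc n)
    ≡⟨ cong (_+ f (suc n)) (sumTo-reverse n f) ⟩
      sumTo n (λ a → f (n ∸ a)) + f (suc n)
    ≡⟨ ℤP.+-comm (sumTo n (λ a → f (n ∸ a))) (f (suc n)) ⟩
      f (suc n) + sumTo n (λ a → f (suc n ∸ suc a))
    ≡⟨ sym (sumTo-suc n (λ a → f (suc n ∸ a))) ⟩
      sumTo (suc n) (λ a → f (suc n ∸ a))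
    ∎
    where open ≡-Reasoning

  sumTo-triangle : ∀ n (h : ℕ → ℕ → ℤ) →
    sumTo n (λ a → sumTo a (λ a' → h a' a)) ≡ sumTo n (λ a' → sumTo (n ∸ a') (λ c → h a' (a' ℕ.+ c)))
  sumTo-triangle zero    h = refl
  sumTo-triangle (suc n) h =
    begin
      sumTo n (λ a → sumTo a (λ a' → h a' a)) + sumTo (suc n) (λ a' → h a' (suc n))
    ≡⟨ cong (_+ sumTo (suc n) (λ a' → h a' (suc n))) (sumTo-triangle n h) ⟩
      Rect n + (sumTo n (λ a' → h a' (suc n)) + h (suc n) (suc n))
    ≡⟨ sym (ℤP.+-assoc (Rect n) (sumTo n (λ a' → h a' (suc n))) (h (suc n) (suc n))) ⟩
      (Rect n + sumTo n (λ a' → h a' (suc n))) + h (suc n) (suc n)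
    ≡⟨ cong₂ _+_ (sym (sumTo-+ n _ _)) (cong (h (suc n)) (sym (ℕP.+-identityʳ (suc n)))) ⟩
      sumTo n (λ a' → sumTo (n ∸ a') (λ c → h a' (a' ℕ.+ c)) + h a' (suc n)) + h (suc n) (suc n ℕ.+ 0)
    ≡⟨ cong (_+ h (suc n) (suc n ℕ.+ 0)) (sumTo-cong-≤ n extendRow) ⟩
      sumTo n (λ a' → sumTo (suc n ∸ a') (λ c → h a' (a' ℕ.+ c))) + h (suc n) (suc n ℕ.+ 0)
    ≡⟨ cong (λ z → sumTo n (λ a' → sumTo (suc n ∸ a') (λ c → h a' (a' ℕ.+ c)))
                   + sumTo z (λ c → h (suc n) (suc n ℕ.+ c))) (sym (ℕP.n∸n≡0 n)) ⟩
      sumTo (suc n) (λ a' → sumTo (suc n ∸ a') (λ c → h a' (a' ℕ.+ c)))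
    ∎
    where
    open ≡-Reasoning
    Rect : ℕ → ℤ
    Rect n = sumTo n (λ a' → sumTo (n ∸ a') (λ c → h a' (a' ℕ.+ c)))
    extendRow : ∀ a' → a' ≤ n →
      sumTo (n ∸ a') (λ c → h a' (a' ℕ.+ c)) + h a' (suc n) ≡ sumTo (suc n ∸ a') (λ c → h a' (a' ℕ.+ c))
    extendRow a' a'≤n rewrite ℕP.+-∸-assoc 1 a'≤n =
      cong (λ z → sumTo (n ∸ a') (λ c → h a' (a' ℕ.+ c)) + h a' z)
           (trans (cong suc (sym (ℕP.m+[n∸m]≡n a'≤n))) (sym (ℕP.+-suc a' (n ∸ a'))))

  ΣFinℤ : ∀ {k} → (Fin k → ℤ) → ℤ
  ΣFinℤ {zero}  f = 0ℤ
  ΣFinℤ {suc k} f = f zero + ΣFinℤ (λ j → f (suc j))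

  ΣFinℤ-cong : ∀ {k} {f g : Fin k → ℤ} → (∀ j → f j ≡ g j) → ΣFinℤ f ≡ ΣFinℤ g
  ΣFinℤ-cong {zero}  eq = refl
  ΣFinℤ-cong {suc k} eq = cong₂ _+_ (eq zero) (ΣFinℤ-cong (λ j → eq (suc j)))

  ΣFinℤ-0 : ∀ {k} (f : Fin k → ℤ) → (∀ j → f j ≡ 0ℤ) → ΣFinℤ f ≡ 0ℤ
  ΣFinℤ-0 {zero}  f eq = refl
  ΣFinℤ-0 {suc k} f eq rewrite eq zero | ΣFinℤ-0 (λ j → f (suc j)) (λ j → eq (suc j)) = refl

  ΣFinℤ-unique : ∀ {k} (f : Fin k → ℤ) j₀ → f j₀ ≡ 1ℤ → (∀ j → j ≢ j₀ → f j ≡ 0ℤ) → ΣFinℤ f ≡ 1ℤ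
  ΣFinℤ-unique {suc k} f zero      f≡1 others
    rewrite f≡1 | ΣFinℤ-0 (λ j → f (suc j)) (λ j → others (suc j) (λ ())) = refl
  ΣFinℤ-unique {suc k} f (suc j₀) f≡1 others rewrite others zero (λ ()) =
    trans (ℤP.+-identityˡ _)
          (ΣFinℤ-unique (λ j → f (suc j)) j₀ f≡1 (λ j j≢j₀ → others (suc j) (λ e → j≢j₀ (FP.suc-injective e))))

  ΣFinℤ-*ˡ : ∀ {k} c (f : Fin k → ℤ) → c * ΣFinℤ f ≡ ΣFinℤ (λ j → c * f j)
  ΣFinℤ-*ˡ {zero}  c f = ℤP.*-zeroʳ c
  ΣFinℤ-*ˡ {suc k} c f =
    trans (ℤP.*-distribˡ-+ c (f zero) _) (cong (c * f zero +_) (ΣFinℤ-*ˡ c (λ j → f (suc j))))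

  ΣFinℤ-neg : ∀ {k} (f : Fin k → ℤ) → ΣFinℤ (λ j → - f j) ≡ - ΣFinℤ f
  ΣFinℤ-neg {zero}  f = refl
  ΣFinℤ-neg {suc k} f =
    trans (cong (- f zero +_) (ΣFinℤ-neg (λ j → f (suc j)))) (sym (ℤP.neg-distrib-+ (f zero) _))

  ΣFin-coeff : ∀ {k} (f : Fin k → PS) n m → ΣFin f n m ≡ ΣFinℤ (λ j → f j n m)
  ΣFin-coeff {zero}  f n m = refl
  ΣFin-coeff {suc k} f n m = cong (f zero n m +_) (ΣFin-coeff (λ j → f (suc j)) n m)

module PowerSeries where

  open FiniteSums
  open import Data.Nat as ℕ using (ℕ; zero; suc; _∸_; _≤_; _<_; z≤n; s≤s)
  open import Data.Nat.Properties as ℕP using ()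
  open import Data.Integer as ℤ using (ℤ; 0ℤ; 1ℤ; -[1+_]; _+_; _*_; -_)
  open import Data.Integer.Properties as ℤP using ()
  open import Relation.Binary.PropositionalEquality
  open import Data.Empty using (⊥-elim)
  open import Data.Unit using (tt)
  open import Data.Bool using (true; false; if_then_else_; T)
  open import Data.Product using (_,_)
  open import Data.Sum using (_⊎_; inj₁; inj₂)
  open import Relation.Nullary using (yes; no)
  open import Algebra.Bundles using (CommutativeRing)
  open import Algebra.Structures using (IsCommutativeRing)
  open import Relation.Binary.Structures using (IsEquivalence)

  δ : ℕ → ℕ → ℤ
  δ a a₀ = if a ℕ.≡ᵇ a₀ then 1ℤ else 0ℤ

  δ-same : ∀ {a a₀} → a ≡ a₀ → δ a a₀ ≡ 1ℤ
  δ-same {a} {a₀} a≡a₀ with a ℕ.≡ᵇ a₀ in eq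
  ... | true  = refl
  ... | false = ⊥-elim (subst T eq (ℕP.≡⇒≡ᵇ a a₀ a≡a₀))

  δ-distinct : ∀ {a a₀} → a ≢ a₀ → δ a a₀ ≡ 0ℤ
  δ-distinct {a} {a₀} a≢a₀ with a ℕ.≡ᵇ a₀ in eq
  ... | true  = ⊥-elim (a≢a₀ (ℕP.≡ᵇ⇒≡ a a₀ (subst T (sym eq) tt)))
  ... | false = refl

  mono-δ : ∀ c a₀ b₀ a b → mono c a₀ b₀ a b ≡ δ a a₀ * (δ b b₀ * c)
  mono-δ c a₀ b₀ a b with a ℕ.≡ᵇ a₀ | b ℕ.≡ᵇ b₀
  ... | true  | true  = sym (trans (ℤP.*-identityˡ _) (ℤP.*-identityˡ c))
  ... | true  | false = sym (trans (ℤP.*-identityˡ _) (ℤP.*-zeroˡ c))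
  ... | false | true  = sym (ℤP.*-zeroˡ (1ℤ * c))
  ... | false | false = sym (ℤP.*-zeroˡ (0ℤ * c))

  sumTo-δ : ∀ n a₀ (f : ℕ → ℤ) → a₀ ≤ n → sumTo n (λ a → δ a a₀ * f a) ≡ f a₀
  sumTo-δ zero .zero f z≤n = ℤP.*-identityˡ (f 0)
  sumTo-δ (suc n) a₀ f a₀≤1+n with a₀ ℕP.≟ suc n
  ... | yes refl =
    trans (cong (_+ (δ (suc n) (suc n) * f (suc n))) (sumTo-0 n earlierTerm))
          (trans (ℤP.+-identityˡ _)
                 (trans (cong (_* f (suc n)) (δ-same {suc n} refl)) (ℤP.*-identityˡ _)))
    where earlierTerm : ∀ a → a ≤ n → δ a (suc n) * f a ≡ 0ℤ
          earlierTerm a a≤n rewrite δ-distinct {a} {suc n} (λ e → ℕP.<-irrefl e (s≤s a≤n)) =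
            ℤP.*-zeroˡ (f a)
  ... | no a₀≢1+n =
    trans (cong₂ _+_ (sumTo-δ n a₀ f (ℕP.≤-pred (ℕP.≤∧≢⇒< a₀≤1+n a₀≢1+n)))
                     (trans (cong (_* f (suc n)) (δ-distinct (λ e → a₀≢1+n (sym e))))
                            (ℤP.*-zeroˡ (f (suc n)))))
          (ℤP.+-identityʳ _)

  sumTo-δ-outside : ∀ n a₀ (f : ℕ → ℤ) → n < a₀ → sumTo n (λ a → δ a a₀ * f a) ≡ 0ℤ
  sumTo-δ-outside n a₀ f n<a₀ =
    sumTo-0 n (λ a a≤n →
      trans (cong (_* f a) (δ-distinct (λ e → ℕP.<-irrefl refl (ℕP.≤-<-trans (subst (_≤ n) e a≤n) n<a₀))))
            (ℤP.*-zeroˡ (f a)))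

  mono-*-as-δ : ∀ c a₀ b₀ (F : PS) n m → (mono c a₀ b₀ *PS F) n m
    ≡ sumTo n (λ a → δ a a₀ * sumTo m (λ b → δ b b₀ * (c * F (n ∸ a) (m ∸ b))))
  mono-*-as-δ c a₀ b₀ F n m =
    sumTo-cong n (λ a →
      trans (sumTo-cong m (λ b →
              trans (cong (_* F (n ∸ a) (m ∸ b)) (mono-δ c a₀ b₀ a b))
                    (trans (ℤP.*-assoc (δ a a₀) _ _) (cong (δ a a₀ *_) (ℤP.*-assoc (δ b b₀) c _)))))
            (sym (sumTo-*ˡ m (δ a a₀) _)))

  mono-*-coeff : ∀ c a₀ b₀ (F : PS) n m → a₀ ≤ n → b₀ ≤ m →
    (mono c a₀ b₀ *PS F) n m ≡ c * F (n ∸ a₀) (m ∸ b₀)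
  mono-*-coeff c a₀ b₀ F n m a₀≤n b₀≤m =
    trans (mono-*-as-δ c a₀ b₀ F n m)
          (trans (sumTo-δ n a₀ _ a₀≤n) (sumTo-δ m b₀ _ b₀≤m))

  mono-*-coeff-vanish : ∀ c a₀ b₀ (F : PS) n m → n < a₀ ⊎ m < b₀ → (mono c a₀ b₀ *PS F) n m ≡ 0ℤ
  mono-*-coeff-vanish c a₀ b₀ F n m out = trans (mono-*-as-δ c a₀ b₀ F n m) (vanish out)
    where
    vanish : n < a₀ ⊎ m < b₀ →
      sumTo n (λ a → δ a a₀ * sumTo m (λ b → δ b b₀ * (c * F (n ∸ a) (m ∸ b)))) ≡ 0ℤ
    vanish (inj₁ n<a₀) = sumTo-δ-outside n a₀ _ n<a₀
    vanish (inj₂ m<b₀) =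
      sumTo-0 n (λ a _ → trans (cong (δ a a₀ *_) (sumTo-δ-outside m b₀ _ m<b₀)) (ℤP.*-zeroʳ (δ a a₀)))

  -- commutativity: reverse both summations
  *PS-comm : ∀ F G → (F *PS G) ≈PS (G *PS F)
  *PS-comm F G n m =
    begin
      sumTo n (λ a → sumTo m (λ b → F a b * G (n ∸ a) (m ∸ b)))
    ≡⟨ trans (sumTo-reverse n _) (sumTo-cong n (λ a → sumTo-reverse m _)) ⟩
      sumTo n (λ a → sumTo m (λ b → F (n ∸ a) (m ∸ b) * G (n ∸ (n ∸ a)) (m ∸ (m ∸ b))))
    ≡⟨ sumTo-cong-≤ n (λ a a≤n → sumTo-cong-≤ m (λ b b≤m →
         trans (cong₂ (λ x y → F (n ∸ a) (m ∸ b) * G x y) (ℕP.m∸[m∸n]≡n a≤n) (ℕP.m∸[m∸n]≡n b≤m))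
               (ℤP.*-comm (F (n ∸ a) (m ∸ b)) (G a b)))) ⟩
      sumTo n (λ a → sumTo m (λ b → G a b * F (n ∸ a) (m ∸ b)))
    ∎
    where open ≡-Reasoning

  -- associativity: exchange the summations over the two triangles
  *PS-assoc : ∀ F G H → ((F *PS G) *PS H) ≈PS (F *PS (G *PS H))
  *PS-assoc F G H n m =
    begin
      sumTo n (λ a → sumTo m (λ b → sumTo a (λ a' → sumTo b (λ b' → F a' b' * G (a ∸ a') (b ∸ b'))) * H (n ∸ a) (m ∸ b)))
    ≡⟨ sumTo-cong n (λ a → sumTo-cong m (λ b → trans (sumTo-*ʳ a _ _) (sumTo-cong a (λ a' → sumTo-*ʳ b _ _)))) ⟩
      sumTo n (λ a → sumTo m (λ b → sumTo a (λ a' → sumTo b (λ b' → F a' b' * G (a ∸ a') (b ∸ b') * H (n ∸ a) (m ∸ b)))))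
    ≡⟨ sumTo-cong n (λ a → sumTo-swap m a _) ⟩
      sumTo n (λ a → sumTo a (λ a' → sumTo m (λ b → sumTo b (λ b' → F a' b' * G (a ∸ a') (b ∸ b') * H (n ∸ a) (m ∸ b)))))
    ≡⟨ sumTo-cong n (λ a → sumTo-cong a (λ a' → sumTo-triangle m (λ b' b → F a' b' * G (a ∸ a') (b ∸ b') * H (n ∸ a) (m ∸ b)))) ⟩
      sumTo n (λ a → sumTo a (λ a' → sumTo m (λ b' → sumTo (m ∸ b') (λ c → F a' b' * G (a ∸ a') ((b' ℕ.+ c) ∸ b') * H (n ∸ a) (m ∸ (b' ℕ.+ c))))))
    ≡⟨ sumTo-triangle n (λ a' a → sumTo m (λ b' → sumTo (m ∸ b') (λ c → F a' b' * G (a ∸ a') ((b' ℕ.+ c) ∸ b') * H (n ∸ a) (m ∸ (b' ℕ.+ c))))) ⟩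
      sumTo n (λ a' → sumTo (n ∸ a') (λ d → sumTo m (λ b' → sumTo (m ∸ b') (λ c → F a' b' * G ((a' ℕ.+ d) ∸ a') ((b' ℕ.+ c) ∸ b') * H (n ∸ (a' ℕ.+ d)) (m ∸ (b' ℕ.+ c))))))
    ≡⟨ sumTo-cong n (λ a' → sumTo-cong (n ∸ a') (λ d → sumTo-cong m (λ b' → sumTo-cong (m ∸ b') (λ c →
         trans (cong₂ (λ x y → F a' b' * G x y * H (n ∸ (a' ℕ.+ d)) (m ∸ (b' ℕ.+ c))) (ℕP.m+n∸m≡n a' d) (ℕP.m+n∸m≡n b' c))
         (trans (cong₂ (λ x y → F a' b' * G d c * H x y) (sym (ℕP.∸-+-assoc n a' d)) (sym (ℕP.∸-+-assoc m b' c)))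
         (ℤP.*-assoc (F a' b') _ _)))))) ⟩
      sumTo n (λ a' → sumTo (n ∸ a') (λ d → sumTo m (λ b' → sumTo (m ∸ b') (λ c → F a' b' * (G d c * H (n ∸ a' ∸ d) (m ∸ b' ∸ c))))))
    ≡⟨ sumTo-cong n (λ a' → sym (sumTo-swap m (n ∸ a') _)) ⟩
      sumTo n (λ a' → sumTo m (λ b' → sumTo (n ∸ a') (λ d → sumTo (m ∸ b') (λ c → F a' b' * (G d c * H (n ∸ a' ∸ d) (m ∸ b' ∸ c))))))
    ≡⟨ sumTo-cong n (λ a' → sumTo-cong m (λ b' → sym (trans (sumTo-*ˡ (n ∸ a') (F a' b') _)
                                                       (sumTo-cong (n ∸ a') (λ d → sumTo-*ˡ (m ∸ b') (F a' b') _))))) ⟩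
      sumTo n (λ a' → sumTo m (λ b' → F a' b' * sumTo (n ∸ a') (λ d → sumTo (m ∸ b') (λ c → G d c * H (n ∸ a' ∸ d) (m ∸ b' ∸ c)))))
    ∎
    where open ≡-Reasoning

  *PS-distribˡ : ∀ F G H → (F *PS (G +PS H)) ≈PS ((F *PS G) +PS (F *PS H))
  *PS-distribˡ F G H n m =
    trans (sumTo-cong n (λ a → trans (sumTo-cong m (λ b → ℤP.*-distribˡ-+ (F a b) _ _)) (sumTo-+ m _ _)))
          (sumTo-+ n _ _)

  *PS-identityˡ : ∀ F → (1PS *PS F) ≈PS F
  *PS-identityˡ F n m = trans (mono-*-coeff 1ℤ 0 0 F n m z≤n z≤n) (ℤP.*-identityˡ _)

  *PS-cong : ∀ {F F' G G'} → F ≈PS F' → G ≈PS G' → (F *PS G) ≈PS (F' *PS G')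
  *PS-cong F≈F' G≈G' n m =
    sumTo-cong n (λ a → sumTo-cong m (λ b → cong₂ _*_ (F≈F' a b) (G≈G' (n ∸ a) (m ∸ b))))

  PS-isCommutativeRing : IsCommutativeRing _≈PS_ _+PS_ _*PS_ -PS_ 0PS 1PS
  PS-isCommutativeRing = record
    { isRing = record
      { +-isAbelianGroup = record
        { isGroup = record
          { isMonoid = record
            { isSemigroup = record
              { isMagma = record
                { isEquivalence = ≈PS-isEquivalence
                ; ∙-cong = λ p q n m → cong₂ _+_ (p n m) (q n m) }
              ; assoc = λ F G H n m → ℤP.+-assoc (F n m) (G n m) (H n m) }
            ; identity = (λ F n m → ℤP.+-identityˡ (F n m)) , (λ F n m → ℤP.+-identityʳ (F n m)) }
          ; inverse = (λ F n m → ℤP.+-inverseˡ (F n m)) , (λ F n m → ℤP.+-inverseʳ (F n m))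
          ; ⁻¹-cong = λ p n m → cong -_ (p n m) }
        ; comm = λ F G n m → ℤP.+-comm (F n m) (G n m) }
      ; *-cong = *PS-cong
      ; *-assoc = *PS-assoc
      ; *-identity = *PS-identityˡ , (λ F n m → trans (*PS-comm F 1PS n m) (*PS-identityˡ F n m))
      ; distrib = *PS-distribˡ , (λ F G H n m → trans (*PS-comm (G +PS H) F n m)
          (trans (*PS-distribˡ F G H n m) (cong₂ _+_ (*PS-comm F G n m) (*PS-comm F H n m)))) }
    ; *-comm = *PS-comm }
    where
    ≈PS-isEquivalence : IsEquivalence _≈PS_
    ≈PS-isEquivalence = record
      { refl = λ n m → refl ; sym = λ p n m → sym (p n m) ; trans = λ p q n m → trans (p n m) (q n m) }

  PSRing : CommutativeRing _ _
  PSRing = record { isCommutativeRing = PS-isCommutativeRing }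

  -- ℤ has no 2-torsion, hence neither has PS; this turns "det A = − det A"
  -- into "det A = 0" for a matrix with two equal columns
  PS-noTwoTorsion : ∀ F → F ≈PS (-PS F) → F ≈PS 0PS
  PS-noTwoTorsion F F≈-F n m = noTwoTorsion (F n m) (F≈-F n m)
    where noTwoTorsion : ∀ z → z ≡ - z → z ≡ 0ℤ
          noTwoTorsion (ℤ.+_ zero)    _ = refl
          noTwoTorsion (ℤ.+_ (suc k)) ()
          noTwoTorsion -[1+ k ]       ()

  x-shift : ∀ F n m → (xPS *PS F) (suc n) m ≡ F n m
  x-shift F n m = trans (mono-*-coeff 1ℤ 1 0 F (suc n) m (s≤s z≤n) z≤n) (ℤP.*-identityˡ _)

  x-shift-0 : ∀ F m → (xPS *PS F) 0 m ≡ 0ℤ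
  x-shift-0 F m = mono-*-coeff-vanish 1ℤ 1 0 F 0 m (inj₁ (s≤s z≤n))

  q-shift : ∀ F n m → (qPS *PS F) n (suc m) ≡ F n m
  q-shift F n m = trans (mono-*-coeff 1ℤ 0 1 F n (suc m) z≤n (s≤s z≤n)) (ℤP.*-identityˡ _)

  q-shift-0 : ∀ F n → (qPS *PS F) n 0 ≡ 0ℤ
  q-shift-0 F n = mono-*-coeff-vanish 1ℤ 0 1 F n 0 (inj₂ (s≤s z≤n))

  x-coeff-q : ∀ n m → xPS (suc n) (suc m) ≡ 0ℤ
  x-coeff-q n m = trans (mono-δ 1ℤ 1 0 (suc n) (suc m)) (ℤP.*-zeroʳ (δ (suc n) 1))

module Determinant where

  open PowerSeries
  open import Data.Nat as ℕ using (ℕ; zero; suc; _≤_; _<_; s≤s)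
  open import Data.Nat.Properties as ℕP using ()
  open import Data.Integer.Properties as ℤP using ()
  open import Data.Fin as F using (Fin; zero; suc; toℕ; punchIn)
  open import Data.Fin.Properties as FP using ()
  open import Data.Fin.Permutation.Components using (transpose)
  open import Relation.Binary.PropositionalEquality as P using (_≡_; _≢_; refl)
  open import Relation.Binary.Definitions using (tri<; tri≈; tri>)
  open import Data.Empty using (⊥-elim)
  open import Data.Product using (_,_; _×_; proj₁; proj₂)
  open import Data.Sum using (_⊎_; inj₁; inj₂)
  open import Relation.Nullary using (yes; no)
  open import Algebra.Bundles using (CommutativeRing; Ring)
  import Algebra.Properties.RingWithoutOne as RingWithoutOneProperties
  import Algebra.Properties.AbelianGroup as AbelianGroupProperties
  import Algebra.Properties.CommutativeSemigroup as CommutativeSemigroupProperties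
  import Relation.Binary.Reasoning.Setoid as SetoidReasoning

  module R = CommutativeRing PSRing
  open R using (_≈_; setoid) renaming (refl to ≈-refl; sym to ≈-sym; trans to ≈-trans)
  open RingWithoutOneProperties (Ring.ringWithoutOne R.ring) using (-‿distribˡ-*; -‿distribʳ-*)
  open AbelianGroupProperties R.+-abelianGroup using (⁻¹-involutive; ⁻¹-∙-comm)
  open CommutativeSemigroupProperties R.+-commutativeSemigroup using (interchange)
  open SetoidReasoning setoid

  ≡⇒≈ : ∀ {F G} → F ≡ G → F ≈ G
  ≡⇒≈ refl = ≈-refl

  Mat : ℕ → Set
  Mat n = Fin n → Fin n → PS

  minor : ∀ {n} → Mat (suc n) → Fin (suc n) → Mat n
  minor A j r c = A (suc r) (punchIn j c)

  laplaceTerm : ∀ {n} → Mat (suc n) → Fin (suc n) → PS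
  laplaceTerm A j = sign (toℕ j) *PS A zero j *PS det (minor A j)

  ΣFin-cong : ∀ {n} {f g : Fin n → PS} → (∀ j → f j ≈ g j) → ΣFin f ≈ ΣFin g
  ΣFin-cong {zero}  eq = ≈-refl
  ΣFin-cong {suc n} eq = R.+-cong (eq zero) (ΣFin-cong (λ j → eq (suc j)))

  ΣFin-+ : ∀ {n} (f g : Fin n → PS) → ΣFin (λ j → f j +PS g j) ≈ (ΣFin f +PS ΣFin g)
  ΣFin-+ {zero}  f g = ≈-sym (R.+-identityʳ 0PS)
  ΣFin-+ {suc n} f g =
    ≈-trans (R.+-cong (≈-refl {f zero +PS g zero}) (ΣFin-+ (λ j → f (suc j)) (λ j → g (suc j))))
            (interchange (f zero) (g zero) (ΣFin (λ j → f (suc j))) (ΣFin (λ j → g (suc j))))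

  ΣFin-*ˡ : ∀ {n} s (f : Fin n → PS) → (s *PS ΣFin f) ≈ ΣFin (λ j → s *PS f j)
  ΣFin-*ˡ {zero}  s f = R.zeroʳ s
  ΣFin-*ˡ {suc n} s f =
    ≈-trans (R.distribˡ s (f zero) (ΣFin (λ j → f (suc j)))) (R.+-cong (≈-refl {s *PS f zero}) (ΣFin-*ˡ s (λ j → f (suc j))))

  ΣFin-neg : ∀ {n} (f : Fin n → PS) → (-PS ΣFin f) ≈ ΣFin (λ j → -PS f j)
  ΣFin-neg {zero}  f n m = refl
  ΣFin-neg {suc n} f =
    ≈-trans (≈-sym (⁻¹-∙-comm (f zero) (ΣFin (λ j → f (suc j)))))
            (R.+-cong (≈-refl { -PS f zero}) (ΣFin-neg (λ j → f (suc j))))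

  ΣFin-0 : ∀ {n} (f : Fin n → PS) → (∀ j → f j ≈ 0PS) → ΣFin f ≈ 0PS
  ΣFin-0 {zero}  f eq = ≈-refl
  ΣFin-0 {suc n} f eq =
    ≈-trans (R.+-cong (eq zero) (ΣFin-0 (λ j → f (suc j)) (λ j → eq (suc j)))) (R.+-identityˡ 0PS)

  det-cong : ∀ {n} {A B : Mat n} → (∀ r c → A r c ≈ B r c) → det A ≈ det B
  det-cong {zero}  eq = ≈-refl
  det-cong {suc n} eq =
    ΣFin-cong (λ j → R.*-cong (R.*-cong (≈-refl {sign (toℕ j)}) (eq zero j))
                              (det-cong (λ r c → eq (suc r) (punchIn j c))))

  sign-suc : ∀ q → sign (suc q) ≈ (-PS sign q)
  sign-suc zero          n m = refl
  sign-suc (suc zero)    n m = P.sym (ℤP.neg-involutive _)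
  sign-suc (suc (suc q))     = sign-suc q

  signed-term-suc : ∀ q y z → (sign (suc q) *PS y *PS z) ≈ (-PS (sign q *PS y *PS z))
  signed-term-suc q y z =
    begin
      sign (suc q) *PS y *PS z
    ≈⟨ R.*-cong (R.*-cong (sign-suc q) (≈-refl {y})) (≈-refl {z}) ⟩
      (-PS sign q) *PS y *PS z
    ≈⟨ R.*-cong (≈-sym (-‿distribˡ-* (sign q) y)) (≈-refl {z}) ⟩
      (-PS (sign q *PS y)) *PS z
    ≈⟨ ≈-sym (-‿distribˡ-* (sign q *PS y) z) ⟩
      -PS (sign q *PS y *PS z)
    ∎

  signed-term-pred : ∀ q y z → (sign q *PS y *PS z) ≈ (-PS (sign (suc q) *PS y *PS z))
  signed-term-pred q y z =
    ≈-trans (≈-sym (⁻¹-involutive (sign q *PS y *PS z))) (R.-‿cong (≈-sym (signed-term-suc q y z)))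

  punchIn-below : ∀ {n} (j : Fin (suc n)) (c : Fin n) → toℕ c < toℕ j → toℕ (punchIn j c) ≡ toℕ c
  punchIn-below (suc j) zero    _         = refl
  punchIn-below (suc j) (suc c) (s≤s c<j) = P.cong suc (punchIn-below j c c<j)

  punchIn-above : ∀ {n} (j : Fin (suc n)) (c : Fin n) → toℕ j ≤ toℕ c → toℕ (punchIn j c) ≡ suc (toℕ c)
  punchIn-above zero    c       _         = refl
  punchIn-above (suc j) (suc c) (s≤s j≤c) = P.cong suc (punchIn-above j c j≤c)

  -- Deleting column q or column q+1 re-indexes the remaining columns in the same way,
  -- except at position q, where the two re-indexings pick columns q+1 and q respectively.
  punchIn-adjacent : ∀ {n} (j j' : Fin (suc n)) (d : Fin n) {q} → toℕ j ≡ q → toℕ j' ≡ suc q →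
      (toℕ (punchIn j' d) ≡ q × toℕ (punchIn j d) ≡ suc q)
    ⊎ (punchIn j d ≡ punchIn j' d × toℕ (punchIn j d) ≢ q × toℕ (punchIn j d) ≢ suc q)
  punchIn-adjacent j j' d refl j'≡1+j with ℕP.<-cmp (toℕ d) (toℕ j)
  ... | tri< d<j _ _ =
    inj₂ ( FP.toℕ-injective (P.trans e (P.sym e'))
         , (λ x → ℕP.<-irrefl (P.trans (P.sym e) x) d<j)
         , (λ x → ℕP.<-irrefl (P.trans (P.sym e) x) (ℕP.m≤n⇒m≤1+n d<j)) )
    where e  = punchIn-below j d d<j
          e' = punchIn-below j' d (P.subst (toℕ d <_) (P.sym j'≡1+j) (ℕP.m≤n⇒m≤1+n d<j))
  ... | tri≈ _ d≡j _ =
    inj₁ ( P.trans (punchIn-below j' d (P.subst (toℕ d <_) (P.sym j'≡1+j) (s≤s (ℕP.≤-reflexive d≡j)))) d≡j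
         , P.trans (punchIn-above j d (ℕP.≤-reflexive (P.sym d≡j))) (P.cong suc d≡j) )
  ... | tri> _ _ j<d =
    inj₂ ( FP.toℕ-injective (P.trans e (P.sym e'))
         , (λ x → ℕP.<-irrefl (P.sym (P.trans (P.sym e) x)) (ℕP.m≤n⇒m≤1+n j<d))
         , (λ x → ℕP.<-irrefl (P.sym (ℕP.suc-injective (P.trans (P.sym e) x))) j<d) )
    where e  = punchIn-above j d (ℕP.<⇒≤ j<d)
          e' = punchIn-above j' d (P.subst (_≤ toℕ d) (P.sym j'≡1+j) j<d)

  SwapsColumns : ∀ {N} → ℕ → Mat N → Mat N → Set
  SwapsColumns q A A' =
      (∀ r c c' → toℕ c ≡ q → toℕ c' ≡ suc q → (A' r c ≈ A r c') × (A' r c' ≈ A r c))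
    × (∀ r c → toℕ c ≢ q → toℕ c ≢ suc q → A' r c ≈ A r c)

  minor-swapped : ∀ {n} {q} {A A' : Mat (suc n)} → SwapsColumns q A A' → ∀ (j j' : Fin (suc n)) →
    toℕ j ≡ q → toℕ j' ≡ suc q →
    (∀ r d → minor A' j r d ≈ minor A j' r d) × (∀ r d → minor A' j' r d ≈ minor A j r d)
  minor-swapped {A = A} {A'} (adjacent , elsewhere) j j' j≡q j'≡1+q = left , right
    where
    left : ∀ r d → minor A' j r d ≈ minor A j' r d
    left r d with punchIn-adjacent j j' d j≡q j'≡1+q
    ... | inj₁ (e' , e) = proj₂ (adjacent (suc r) (punchIn j' d) (punchIn j d) e' e)
    ... | inj₂ (same , ≢q , ≢1+q) =
      P.subst (λ x → A' (suc r) (punchIn j d) ≈ A (suc r) x) same (elsewhere (suc r) (punchIn j d) ≢q ≢1+q)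
    right : ∀ r d → minor A' j' r d ≈ minor A j r d
    right r d with punchIn-adjacent j j' d j≡q j'≡1+q
    ... | inj₁ (e' , e) = proj₁ (adjacent (suc r) (punchIn j' d) (punchIn j d) e' e)
    ... | inj₂ (same , ≢q , ≢1+q) =
      P.subst (λ x → A' (suc r) x ≈ A (suc r) (punchIn j d)) same (elsewhere (suc r) (punchIn j d) ≢q ≢1+q)

  minor-swap-shifts : ∀ {n} q (A A' : Mat (suc n)) (j : Fin (suc n)) →
    SwapsColumns (suc q) A A' → toℕ j ≤ q → SwapsColumns q (minor A j) (minor A' j)
  minor-swap-shifts q A A' j (adjacent , elsewhere) j≤q = adjacent' , elsewhere'
    where
    adjacent' : ∀ r c c' → toℕ c ≡ q → toℕ c' ≡ suc q →
      (minor A' j r c ≈ minor A j r c') × (minor A' j r c' ≈ minor A j r c)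
    adjacent' r c c' c≡q c'≡1+q = adjacent (suc r) (punchIn j c) (punchIn j c')
       (P.trans (punchIn-above j c (P.subst (toℕ j ≤_) (P.sym c≡q) j≤q)) (P.cong suc c≡q))
       (P.trans (punchIn-above j c' (P.subst (toℕ j ≤_) (P.sym c'≡1+q) (ℕP.m≤n⇒m≤1+n j≤q))) (P.cong suc c'≡1+q))
    elsewhere' : ∀ r c → toℕ c ≢ q → toℕ c ≢ suc q → minor A' j r c ≈ minor A j r c
    elsewhere' r c ≢q ≢1+q with toℕ c ℕP.<? toℕ j
    ... | yes c<j = let e = punchIn-below j c c<j in
      elsewhere (suc r) (punchIn j c)
        (λ x → ℕP.<-irrefl (P.trans (P.sym e) x) (ℕP.<-≤-trans c<j (ℕP.m≤n⇒m≤1+n j≤q)))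
        (λ x → ℕP.<-irrefl (P.trans (P.sym e) x) (ℕP.<-≤-trans c<j (ℕP.m≤n⇒m≤1+n (ℕP.m≤n⇒m≤1+n j≤q))))
    ... | no c≮j = let e = punchIn-above j c (ℕP.≮⇒≥ c≮j) in
      elsewhere (suc r) (punchIn j c)
        (λ x → ≢q (ℕP.suc-injective (P.trans (P.sym e) x)))
        (λ x → ≢1+q (ℕP.suc-injective (P.trans (P.sym e) x)))

  minor-swap-stays : ∀ {n} q (A A' : Mat (suc n)) (j : Fin (suc n)) →
    SwapsColumns q A A' → suc (suc q) ≤ toℕ j → SwapsColumns q (minor A j) (minor A' j)
  minor-swap-stays q A A' j (adjacent , elsewhere) 2+q≤j = adjacent' , elsewhere'
    where
    adjacent' : ∀ r c c' → toℕ c ≡ q → toℕ c' ≡ suc q →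
      (minor A' j r c ≈ minor A j r c') × (minor A' j r c' ≈ minor A j r c)
    adjacent' r c c' c≡q c'≡1+q = adjacent (suc r) (punchIn j c) (punchIn j c')
       (P.trans (punchIn-below j c (P.subst (_< toℕ j) (P.sym c≡q) (ℕP.<-trans ℕP.≤-refl 2+q≤j))) c≡q)
       (P.trans (punchIn-below j c' (P.subst (_< toℕ j) (P.sym c'≡1+q) 2+q≤j)) c'≡1+q)
    elsewhere' : ∀ r c → toℕ c ≢ q → toℕ c ≢ suc q → minor A' j r c ≈ minor A j r c
    elsewhere' r c ≢q ≢1+q with toℕ c ℕP.<? toℕ j
    ... | yes c<j = let e = punchIn-below j c c<j in
      elsewhere (suc r) (punchIn j c) (λ x → ≢q (P.trans (P.sym e) x)) (λ x → ≢1+q (P.trans (P.sym e) x))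
    ... | no c≮j = let e = punchIn-above j c (ℕP.≮⇒≥ c≮j) ; j≤c = ℕP.≤-trans 2+q≤j (ℕP.≮⇒≥ c≮j) in
      elsewhere (suc r) (punchIn j c)
        (λ x → ℕP.<-irrefl (P.sym (P.trans (P.sym e) x)) (ℕP.<-trans (ℕP.n<1+n q) (ℕP.m≤n⇒m≤1+n j≤c)))
        (λ x → ℕP.<-irrefl (P.sym (P.trans (P.sym e) x)) (s≤s (ℕP.<⇒≤ j≤c)))

  ΣFin-swapAdjacent : ∀ {n} q (f g : Fin n → PS) → suc q < n →
    (∀ c c' → toℕ c ≡ q → toℕ c' ≡ suc q → (g c ≈ f c') × (g c' ≈ f c)) →
    (∀ c → toℕ c ≢ q → toℕ c ≢ suc q → g c ≈ f c) → ΣFin g ≈ ΣFin f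
  ΣFin-swapAdjacent {suc (suc n)} zero f g _ adjacent elsewhere =
    begin
      g zero +PS (g (suc zero) +PS ΣFin (λ j → g (suc (suc j))))
    ≈⟨ R.+-cong (proj₁ (adjacent zero (suc zero) refl refl))
                (R.+-cong (proj₂ (adjacent zero (suc zero) refl refl))
                          (ΣFin-cong (λ j → elsewhere (suc (suc j)) (λ ()) (λ ())))) ⟩
      f (suc zero) +PS (f zero +PS rest)
    ≈⟨ ≈-sym (R.+-assoc (f (suc zero)) (f zero) rest) ⟩
      (f (suc zero) +PS f zero) +PS rest
    ≈⟨ R.+-cong (R.+-comm (f (suc zero)) (f zero)) (≈-refl {rest}) ⟩
      (f zero +PS f (suc zero)) +PS rest
    ≈⟨ R.+-assoc (f zero) (f (suc zero)) rest ⟩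
      f zero +PS (f (suc zero) +PS rest)
    ∎
    where rest = ΣFin (λ j → f (suc (suc j)))
  ΣFin-swapAdjacent {suc n} (suc q) f g (s≤s bound) adjacent elsewhere =
    R.+-cong (elsewhere zero (λ ()) (λ ()))
      (ΣFin-swapAdjacent q (λ j → f (suc j)) (λ j → g (suc j)) bound
         (λ c c' c≡q c'≡1+q → adjacent (suc c) (suc c') (P.cong suc c≡q) (P.cong suc c'≡1+q))
         (λ c ≢q ≢1+q → elsewhere (suc c) (λ e → ≢q (ℕP.suc-injective e)) (λ e → ≢1+q (ℕP.suc-injective e))))

  swapped-terms : ∀ {n} {q} {A A' : Mat (suc n)} → SwapsColumns q A A' → ∀ c c' → toℕ c ≡ q → toℕ c' ≡ suc q →
    (laplaceTerm A' c ≈ (-PS laplaceTerm A c')) × (laplaceTerm A' c' ≈ (-PS laplaceTerm A c))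
  swapped-terms {q = q} {A} {A'} swap@(adjacent , _) c c' c≡q c'≡1+q = atLeft , atRight
    where
    minors = minor-swapped swap c c' c≡q c'≡1+q
    atLeft : laplaceTerm A' c ≈ (-PS laplaceTerm A c')
    atLeft =
      begin
        sign (toℕ c) *PS A' zero c *PS det (minor A' c)
      ≈⟨ R.*-cong (R.*-cong (≡⇒≈ (P.cong sign c≡q)) (proj₁ (adjacent zero c c' c≡q c'≡1+q)))
                  (det-cong (proj₁ minors)) ⟩
        sign q *PS A zero c' *PS det (minor A c')
      ≈⟨ signed-term-pred q (A zero c') (det (minor A c')) ⟩
        -PS (sign (suc q) *PS A zero c' *PS det (minor A c'))
      ≈⟨ R.-‿cong (R.*-cong (R.*-cong (≡⇒≈ (P.cong sign (P.sym c'≡1+q))) (≈-refl {A zero c'}))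
                            (≈-refl {det (minor A c')})) ⟩
        -PS laplaceTerm A c'
      ∎
    atRight : laplaceTerm A' c' ≈ (-PS laplaceTerm A c)
    atRight =
      begin
        sign (toℕ c') *PS A' zero c' *PS det (minor A' c')
      ≈⟨ R.*-cong (R.*-cong (≡⇒≈ (P.cong sign c'≡1+q)) (proj₂ (adjacent zero c c' c≡q c'≡1+q)))
                  (det-cong (proj₂ minors)) ⟩
        sign (suc q) *PS A zero c *PS det (minor A c)
      ≈⟨ signed-term-suc q (A zero c) (det (minor A c)) ⟩
        -PS (sign q *PS A zero c *PS det (minor A c))
      ≈⟨ R.-‿cong (R.*-cong (R.*-cong (≡⇒≈ (P.cong sign (P.sym c≡q))) (≈-refl {A zero c}))
                            (≈-refl {det (minor A c)})) ⟩
        -PS laplaceTerm A c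
      ∎

  -- The terms at the swapped
  -- columns trade places (swapped-terms); every other term keeps the swap in its minor
  -- and is negated by induction on the size.
  det-swapAdjacent : ∀ {N} q (A A' : Mat N) → suc q < N → SwapsColumns q A A' → det A' ≈ (-PS det A)
  det-swapAdjacent {suc n} q A A' bound swap@(_ , elsewhere) =
    ≈-trans (ΣFin-swapAdjacent q (λ j → -PS laplaceTerm A j) (laplaceTerm A') bound
               (swapped-terms swap) otherTerm)
            (≈-sym (ΣFin-neg (laplaceTerm A)))
    where
    minorLeftOfSwap : ∀ c q' → toℕ c < q' → suc q' < suc n → SwapsColumns q' A A' →
      det (minor A' c) ≈ (-PS det (minor A c))
    minorLeftOfSwap c (suc q₀) c<q bound' swap' =
      det-swapAdjacent q₀ (minor A c) (minor A' c) (ℕP.≤-pred bound')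
        (minor-swap-shifts q₀ A A' c swap' (ℕP.≤-pred c<q))
    minorAwayFromSwap : ∀ c → toℕ c ≢ q → toℕ c ≢ suc q → det (minor A' c) ≈ (-PS det (minor A c))
    minorAwayFromSwap c ≢q ≢1+q with ℕP.<-cmp (toℕ c) q
    ... | tri< c<q _ _ = minorLeftOfSwap c q c<q bound swap
    ... | tri≈ _ c≡q _ = ⊥-elim (≢q c≡q)
    ... | tri> _ _ q<c =
      let 2+q≤c = ℕP.≤∧≢⇒< q<c (λ e → ≢1+q (P.sym e)) in
      det-swapAdjacent q (minor A c) (minor A' c) (ℕP.≤-trans 2+q≤c (ℕP.≤-pred (FP.toℕ<n c)))
        (minor-swap-stays q A A' c swap 2+q≤c)
    otherTerm : ∀ c → toℕ c ≢ q → toℕ c ≢ suc q → laplaceTerm A' c ≈ (-PS laplaceTerm A c)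
    otherTerm c ≢q ≢1+q =
      begin
        sign (toℕ c) *PS A' zero c *PS det (minor A' c)
      ≈⟨ R.*-cong (R.*-cong (≈-refl {sign (toℕ c)}) (elsewhere zero c ≢q ≢1+q)) (minorAwayFromSwap c ≢q ≢1+q) ⟩
        sign (toℕ c) *PS A zero c *PS (-PS det (minor A c))
      ≈⟨ ≈-sym (-‿distribʳ-* (sign (toℕ c) *PS A zero c) (det (minor A c))) ⟩
        -PS laplaceTerm A c
      ∎

  transpose-left : ∀ {n} (i j : Fin n) → transpose i j i ≡ j
  transpose-left i j with i FP.≟ i
  ... | yes _   = refl
  ... | no i≢i  = ⊥-elim (i≢i refl)

  transpose-right : ∀ {n} (i j : Fin n) → i ≢ j → transpose i j j ≡ i
  transpose-right i j i≢j with j FP.≟ i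
  ... | yes j≡i = ⊥-elim (i≢j (P.sym j≡i))
  ... | no _ with j FP.≟ j
  ...   | yes _   = refl
  ...   | no j≢j  = ⊥-elim (j≢j refl)

  transpose-other : ∀ {n} (i j k : Fin n) → k ≢ i → k ≢ j → transpose i j k ≡ k
  transpose-other i j k k≢i k≢j with k FP.≟ i
  ... | yes k≡i = ⊥-elim (k≢i k≡i)
  ... | no _ with k FP.≟ j
  ...   | yes k≡j = ⊥-elim (k≢j k≡j)
  ...   | no _    = refl

  swapColumns : ∀ {N} → Fin N → Fin N → Mat N → Mat N
  swapColumns i j A r c = A r (transpose i j c)

  swapColumns-adjacent : ∀ {N} (A : Mat N) (i j : Fin N) → toℕ j ≡ suc (toℕ i) →
    SwapsColumns (toℕ i) A (swapColumns i j A)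
  swapColumns-adjacent A i j j≡1+i = adjacent , elsewhere
    where
    i≢j : i ≢ j
    i≢j i≡j = ℕP.<-irrefl (P.trans (P.cong toℕ i≡j) j≡1+i) (ℕP.n<1+n (toℕ i))
    adjacent : ∀ r c c' → toℕ c ≡ toℕ i → toℕ c' ≡ suc (toℕ i) →
      (swapColumns i j A r c ≈ A r c') × (swapColumns i j A r c' ≈ A r c)
    adjacent r c c' c≡i c'≡1+i
      with FP.toℕ-injective c≡i | FP.toℕ-injective (P.trans c'≡1+i (P.sym j≡1+i))
    ... | refl | refl = ≡⇒≈ (P.cong (A r) (transpose-left c c'))
                      , ≡⇒≈ (P.cong (A r) (transpose-right c c' i≢j))
    elsewhere : ∀ r c → toℕ c ≢ toℕ i → toℕ c ≢ suc (toℕ i) → swapColumns i j A r c ≈ A r c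
    elsewhere r c ≢i ≢1+i =
      ≡⇒≈ (P.cong (A r) (transpose-other i j c (λ e → ≢i (P.cong toℕ e))
                                                   (λ e → ≢1+i (P.trans (P.cong toℕ e) j≡1+i))))

  -- two equal adjacent columns: exchanging them leaves A unchanged, so det A = − det A = 0
  det-equalAdjacentColumns : ∀ {N} (A : Mat N) (i j : Fin N) → toℕ j ≡ suc (toℕ i) →
    (∀ r → A r i ≈ A r j) → det A ≈ 0PS
  det-equalAdjacentColumns {N} A i j j≡1+i equal =
    PS-noTwoTorsion (det A) (det-swapAdjacent (toℕ i) A A bound (adjacent , λ r c _ _ → ≈-refl {A r c}))
    where
    bound : suc (toℕ i) < N
    bound = P.subst (_< N) j≡1+i (FP.toℕ<n j)
    adjacent : ∀ r c c' → toℕ c ≡ toℕ i → toℕ c' ≡ suc (toℕ i) → (A r c ≈ A r c') × (A r c' ≈ A r c)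
    adjacent r c c' c≡i c'≡1+i
      with FP.toℕ-injective c≡i | FP.toℕ-injective (P.trans c'≡1+i (P.sym j≡1+i))
    ... | refl | refl = equal r , ≈-sym (equal r)

  -- A matrix with two equal columns i < j has determinant 0: swapping column j with its
  -- left neighbour negates the determinant and brings the equal columns closer together.
  det-equalColumns : ∀ {N} d (A : Mat N) (i j : Fin N) → toℕ j ≡ toℕ i ℕ.+ suc d →
    (∀ r → A r i ≈ A r j) → det A ≈ 0PS
  det-equalColumns zero A i j j≡i+1 equal =
    det-equalAdjacentColumns A i j (P.trans j≡i+1 (ℕP.+-comm (toℕ i) 1)) equal
  det-equalColumns {N} (suc d) A i j j≡i+2+d equal =
    begin
      det A
    ≈⟨ ≈-sym (⁻¹-involutive (det A)) ⟩
      -PS (-PS det A)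
    ≈⟨ R.-‿cong (≈-sym (det-swapAdjacent (toℕ j₁) A A' j₁-bound (swapColumns-adjacent A j₁ j j≡1+j₁))) ⟩
      -PS det A'
    ≈⟨ R.-‿cong (det-equalColumns d A' i j₁ j₁≡i+1+d equal') ⟩
      -PS 0PS
    ≈⟨ (λ n m → refl) ⟩
      0PS
    ∎
    where
    j≡1+i+1+d : toℕ j ≡ suc (toℕ i ℕ.+ suc d)
    j≡1+i+1+d = P.trans j≡i+2+d (ℕP.+-suc (toℕ i) (suc d))
    bound : suc (toℕ i ℕ.+ suc d) < N
    bound = P.subst (_< N) j≡1+i+1+d (FP.toℕ<n j)
    j₁ : Fin N
    j₁ = F.fromℕ< (ℕP.<-trans ℕP.≤-refl bound)
    j₁≡i+1+d : toℕ j₁ ≡ toℕ i ℕ.+ suc d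
    j₁≡i+1+d = FP.toℕ-fromℕ< _
    j≡1+j₁ : toℕ j ≡ suc (toℕ j₁)
    j≡1+j₁ = P.trans j≡1+i+1+d (P.cong suc (P.sym j₁≡i+1+d))
    j₁-bound : suc (toℕ j₁) < N
    j₁-bound = P.subst (_< N) j≡1+j₁ (FP.toℕ<n j)
    A' : Mat N
    A' = swapColumns j₁ j A
    equal' : ∀ r → A' r i ≈ A' r j₁
    equal' r =
      ≈-trans (≡⇒≈ (P.cong (A r) (transpose-other j₁ j i
                 (λ e → ℕP.m+1+n≢m (toℕ i) (P.sym (P.trans (P.cong toℕ e) j₁≡i+1+d)))
                 (λ e → ℕP.m+1+n≢m (toℕ i) (P.sym (P.trans (P.cong toℕ e) j≡i+2+d))))))
      (≈-trans (equal r) (≡⇒≈ (P.cong (A r) (P.sym (transpose-left j₁ j)))))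

  withColumn0 : ∀ {n} → Mat (suc n) → (Fin (suc n) → PS) → Mat (suc n)
  withColumn0 A v r zero    = v r
  withColumn0 A v r (suc c) = A r (suc c)

  withColumn0-cong : ∀ {n} (A : Mat (suc n)) {u v : Fin (suc n) → PS} → (∀ r → u r ≈ v r) →
    ∀ r c → withColumn0 A u r c ≈ withColumn0 A v r c
  withColumn0-cong A u≈v r zero    = u≈v r
  withColumn0-cong A u≈v r (suc c) = ≈-refl {A r (suc c)}

  withColumn0-own : ∀ {n} (A : Mat (suc n)) → ∀ r c → withColumn0 A (λ r → A r zero) r c ≈ A r c
  withColumn0-own A r zero    = ≈-refl {A r zero}
  withColumn0-own A r (suc c) = ≈-refl {A r (suc c)}

  minor-withColumn0 : ∀ {n} (A : Mat (suc (suc n))) v (j : Fin (suc n)) r c →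
    minor (withColumn0 A v) (suc j) r c ≡ withColumn0 (minor A (suc j)) (λ r → v (suc r)) r c
  minor-withColumn0 A v j r zero    = refl
  minor-withColumn0 A v j r (suc c) = refl

  term-distrib : ∀ s a b D → (s *PS (a +PS b) *PS D) ≈ (s *PS a *PS D +PS s *PS b *PS D)
  term-distrib s a b D = ≈-trans (R.*-cong (R.distribˡ s a b) (≈-refl {D})) (R.distribʳ D (s *PS a) (s *PS b))

  term-scaleˡ : ∀ s k a D → (s *PS (k *PS a) *PS D) ≈ (k *PS (s *PS a *PS D))
  term-scaleˡ s k a D =
    ≈-trans (R.*-cong (≈-trans (≈-sym (R.*-assoc s k a))
                      (≈-trans (R.*-cong (R.*-comm s k) (≈-refl {a})) (R.*-assoc k s a))) (≈-refl {D}))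
            (R.*-assoc k (s *PS a) D)

  term-scaleʳ : ∀ s a k D → (s *PS a *PS (k *PS D)) ≈ (k *PS (s *PS a *PS D))
  term-scaleʳ s a k D =
    ≈-trans (≈-sym (R.*-assoc (s *PS a) k D))
            (≈-trans (R.*-cong (R.*-comm (s *PS a) k) (≈-refl {D})) (R.*-assoc k (s *PS a) D))

  det-column0-+ : ∀ {n} (A : Mat (suc n)) (u v : Fin (suc n) → PS) →
    det (withColumn0 A (λ r → u r +PS v r)) ≈ (det (withColumn0 A u) +PS det (withColumn0 A v))
  det-column0-+ {zero} A u v =
    ≈-trans (R.+-cong (term-distrib (sign 0) (u zero) (v zero) 1PS) (≈-refl {0PS}))
            (ΣFin-+ (laplaceTerm (withColumn0 A u)) (laplaceTerm (withColumn0 A v)))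
  det-column0-+ {suc n} A u v =
    ≈-trans (ΣFin-cong termwise) (ΣFin-+ (laplaceTerm (withColumn0 A u)) (laplaceTerm (withColumn0 A v)))
    where
    minorSplits : ∀ j → det (minor (withColumn0 A (λ r → u r +PS v r)) (suc j)) ≈
      (det (minor (withColumn0 A u) (suc j)) +PS det (minor (withColumn0 A v) (suc j)))
    minorSplits j =
      ≈-trans (det-cong (λ r c → ≡⇒≈ (minor-withColumn0 A (λ r → u r +PS v r) j r c)))
      (≈-trans (det-column0-+ (minor A (suc j)) (λ r → u (suc r)) (λ r → v (suc r)))
               (R.+-cong (≈-sym (det-cong (λ r c → ≡⇒≈ (minor-withColumn0 A u j r c))))
                         (≈-sym (det-cong (λ r c → ≡⇒≈ (minor-withColumn0 A v j r c))))))
    termwise : ∀ j → laplaceTerm (withColumn0 A (λ r → u r +PS v r)) j ≈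
      (laplaceTerm (withColumn0 A u) j +PS laplaceTerm (withColumn0 A v) j)
    termwise zero    = term-distrib (sign 0) (u zero) (v zero) (det (minor A zero))
    termwise (suc j) =
      ≈-trans (R.*-cong (≈-refl {sign (toℕ (suc j)) *PS A zero (suc j)}) (minorSplits j))
              (R.distribˡ (sign (toℕ (suc j)) *PS A zero (suc j))
                           (det (minor (withColumn0 A u) (suc j))) (det (minor (withColumn0 A v) (suc j))))

  det-column0-* : ∀ {n} (A : Mat (suc n)) (k : PS) (u : Fin (suc n) → PS) →
    det (withColumn0 A (λ r → k *PS u r)) ≈ (k *PS det (withColumn0 A u))
  det-column0-* {zero} A k u =
    ≈-trans (R.+-cong (term-scaleˡ (sign 0) k (u zero) 1PS) (≈-sym (R.zeroʳ k)))
            (≈-sym (R.distribˡ k (laplaceTerm (withColumn0 A u) zero) 0PS))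
  det-column0-* {suc n} A k u =
    ≈-trans (ΣFin-cong termwise) (≈-sym (ΣFin-*ˡ k (laplaceTerm (withColumn0 A u))))
    where
    minorScales : ∀ j → det (minor (withColumn0 A (λ r → k *PS u r)) (suc j)) ≈
      (k *PS det (minor (withColumn0 A u) (suc j)))
    minorScales j =
      ≈-trans (det-cong (λ r c → ≡⇒≈ (minor-withColumn0 A (λ r → k *PS u r) j r c)))
      (≈-trans (det-column0-* (minor A (suc j)) k (λ r → u (suc r)))
               (R.*-cong (≈-refl {k}) (≈-sym (det-cong (λ r c → ≡⇒≈ (minor-withColumn0 A u j r c))))))
    termwise : ∀ j → laplaceTerm (withColumn0 A (λ r → k *PS u r)) j ≈ (k *PS laplaceTerm (withColumn0 A u) j)
    termwise zero    = term-scaleˡ (sign 0) k (u zero) (det (minor A zero))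
    termwise (suc j) =
      ≈-trans (R.*-cong (≈-refl {sign (toℕ (suc j)) *PS A zero (suc j)}) (minorScales j))
              (term-scaleʳ (sign (toℕ (suc j))) (A zero (suc j)) k (det (minor (withColumn0 A u) (suc j))))

  det-column0-zero : ∀ {n} (A : Mat (suc n)) → det (withColumn0 A (λ r → 0PS)) ≈ 0PS
  det-column0-zero A =
    begin
      det (withColumn0 A (λ r → 0PS))
    ≈⟨ det-cong (withColumn0-cong A (λ r → ≈-sym (R.zeroˡ 0PS))) ⟩
      det (withColumn0 A (λ r → 0PS *PS 0PS))
    ≈⟨ det-column0-* A 0PS (λ r → 0PS) ⟩
      0PS *PS det (withColumn0 A (λ r → 0PS))
    ≈⟨ R.zeroˡ (det (withColumn0 A (λ r → 0PS))) ⟩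
      0PS
    ∎

  det-column0-Σ : ∀ {n} K (A : Mat (suc n)) (s : Fin K → PS) (w : Fin K → Fin (suc n) → PS) →
    det (withColumn0 A (λ r → ΣFin (λ t → w t r *PS s t))) ≈ ΣFin (λ t → s t *PS det (withColumn0 A (w t)))
  det-column0-Σ zero    A s w = det-column0-zero A
  det-column0-Σ (suc K) A s w =
    ≈-trans (det-column0-+ A (λ r → w zero r *PS s zero) (λ r → ΣFin (λ t → w (suc t) r *PS s (suc t))))
            (R.+-cong (≈-trans (det-cong (withColumn0-cong A (λ r → R.*-comm (w zero r) (s zero))))
                               (det-column0-* A (s zero) (w zero)))
                      (det-column0-Σ K A (λ t → s (suc t)) (λ t → w (suc t))))

  -- Expanding b = Σ_t v_t · (column t of M) by linearity, every term but t = 0 has two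
  -- equal columns.
  cramer-column0 : ∀ {n} (M : Mat (suc n)) (v b : Fin (suc n) → PS) →
    (∀ r → ΣFin (λ j → M r j *PS v j) ≈ b r) → (det M *PS v zero) ≈ det (withColumn0 M b)
  cramer-column0 {n} M v b Mv≈b =
    begin
      det M *PS v zero
    ≈⟨ R.*-comm (det M) (v zero) ⟩
      v zero *PS det M
    ≈⟨ ≈-sym (R.+-identityʳ (v zero *PS det M)) ⟩
      v zero *PS det M +PS 0PS
    ≈⟨ R.+-cong (R.*-cong (≈-refl {v zero}) (≈-sym (det-cong (withColumn0-own M))))
                (≈-sym (ΣFin-0 _ repeatedColumn)) ⟩
      ΣFin (λ t → v t *PS det (withColumn0 M (λ r → M r t)))
    ≈⟨ ≈-sym (det-column0-Σ (suc n) M v (λ t r → M r t)) ⟩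
      det (withColumn0 M (λ r → ΣFin (λ t → M r t *PS v t)))
    ≈⟨ det-cong (withColumn0-cong M Mv≈b) ⟩
      det (withColumn0 M b)
    ∎
    where
    repeatedColumn : ∀ j → (v (suc j) *PS det (withColumn0 M (λ r → M r (suc j)))) ≈ 0PS
    repeatedColumn j =
      ≈-trans (R.*-cong (≈-refl {v (suc j)})
                        (det-equalColumns (toℕ j) (withColumn0 M (λ r → M r (suc j))) zero (suc j) refl
                                          (λ r → ≈-refl {M r (suc j)})))
              (R.zeroʳ (v (suc j)))

  unitColumn : ∀ {n} → PS → Fin (suc n) → PS
  unitColumn o zero    = o
  unitColumn o (suc _) = 0PS

  det-column0-unit : ∀ {n} (M : Mat (suc (suc n))) (o : PS) →
    det (withColumn0 M (unitColumn o)) ≈ (o *PS det (λ r c → M (suc r) (suc c)))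
  det-column0-unit M o =
    ≈-trans (R.+-cong (R.*-cong (R.*-identityˡ o) (≈-refl {det (λ r c → M (suc r) (suc c))}))
                      (ΣFin-0 _ vanishingTerm))
            (R.+-identityʳ (o *PS det (λ r c → M (suc r) (suc c))))
    where
    vanishingTerm : ∀ j → laplaceTerm (withColumn0 M (unitColumn o)) (suc j) ≈ 0PS
    vanishingTerm j =
      ≈-trans (R.*-cong (≈-refl {sign (toℕ (suc j)) *PS M zero (suc j)})
                        (≈-trans (det-cong (λ r c → ≡⇒≈ (minor-withColumn0 M (unitColumn o) j r c)))
                                 (det-column0-zero (minor M (suc j)))))
              (R.zeroʳ (sign (toℕ (suc j)) *PS M zero (suc j)))

module WordSums where

  open FiniteSums
  open PowerSeries
  open import Data.Nat as ℕ using (ℕ; zero; suc; _∸_; _≤_; _<_; s≤s; _≡ᵇ_; _≤ᵇ_)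
  open import Data.Nat.Properties as ℕP using ()
  open import Data.Nat.ListAction using (sum)
  open import Data.Nat.ListAction.Properties using (sum-++)
  open import Data.Integer as ℤ using (ℤ; 0ℤ; 1ℤ; _+_; _*_)
  open import Data.Integer.Properties as ℤP using ()
  open import Data.Integer.Tactic.RingSolver using (solve-∀)
  open import Data.List using (List; []; _∷_; _++_; length; take; drop; map; concatMap; filter; upTo)
  open import Data.List.Properties as LP using ()
  open import Data.List.Relation.Unary.All using (All; []; _∷_)
  open import Data.Bool using (Bool; true; false; if_then_else_; _∧_; T)
  open import Data.Bool.Properties using (T-∧)
  open import Data.Fin using (Fin; zero; suc)
  open import Function.Bundles using (Equivalence)
  open import Relation.Binary.PropositionalEquality
  open import Relation.Nullary using (yes; no; does; Dec; ¬_)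
  open import Data.Empty using (⊥-elim)
  open import Data.Unit using (tt)
  open import Data.Product using (_,_; _×_)
  open import Data.Sum using (inj₁; inj₂)

  𝟙 : Bool → ℤ
  𝟙 b = if b then 1ℤ else 0ℤ

  𝟙-true : ∀ {b} → T b → 𝟙 b ≡ 1ℤ
  𝟙-true {true} _ = refl

  𝟙-false : ∀ {b} → ¬ T b → 𝟙 b ≡ 0ℤ
  𝟙-false {false} _  = refl
  𝟙-false {true}  ¬t = ⊥-elim (¬t tt)

  𝟙-∧ : ∀ a b → 𝟙 (a ∧ b) ≡ 𝟙 a * 𝟙 b
  𝟙-∧ false b = refl
  𝟙-∧ true  b = sym (ℤP.*-identityˡ (𝟙 b))

  bool-ext : ∀ {a b : Bool} → (T a → T b) → (T b → T a) → a ≡ b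
  bool-ext {false} {false} _ _ = refl
  bool-ext {false} {true}  _ g = ⊥-elim (g tt)
  bool-ext {true}  {false} f _ = ⊥-elim (f tt)
  bool-ext {true}  {true}  _ _ = refl

  ≡ᵇ-false : ∀ {x y} → x ≢ y → (x ≡ᵇ y) ≡ false
  ≡ᵇ-false {x} {y} x≢y = bool-ext {x ≡ᵇ y} {false} (λ t → x≢y (ℕP.≡ᵇ⇒≡ x y t)) (λ ())

  ≡ᵇ-shift : ∀ a s n → a ≤ n → (a ℕ.+ s ≡ᵇ n) ≡ (s ≡ᵇ n ∸ a)
  ≡ᵇ-shift a s n a≤n = bool-ext {a ℕ.+ s ≡ᵇ n} {s ≡ᵇ n ∸ a}
    (λ t → ℕP.≡⇒≡ᵇ s (n ∸ a) (trans (sym (ℕP.m+n∸m≡n a s)) (cong (_∸ a) (ℕP.≡ᵇ⇒≡ _ _ t))))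
    (λ t → ℕP.≡⇒≡ᵇ (a ℕ.+ s) n (trans (cong (a ℕ.+_) (ℕP.≡ᵇ⇒≡ _ _ t)) (ℕP.m+[n∸m]≡n a≤n)))

  ≤ᵇ-true : ∀ {a b} → a ≤ b → (a ≤ᵇ b) ≡ true
  ≤ᵇ-true {a} {b} a≤b = bool-ext {a ≤ᵇ b} {true} (λ _ → tt) (λ _ → ℕP.≤⇒≤ᵇ a≤b)

  ≤ᵇ-false : ∀ {a b} → b < a → (a ≤ᵇ b) ≡ false
  ≤ᵇ-false {a} {b} b<a =
    bool-ext {a ≤ᵇ b} {false} (λ t → ℕP.<-irrefl refl (ℕP.<-≤-trans b<a (ℕP.≤ᵇ⇒≤ a b t))) (λ ())

  eqList : List ℕ → List ℕ → Bool
  eqList xs ys = does (LP.≡-dec ℕP._≟_ xs ys)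

  eqList-sound : ∀ {xs ys} → T (eqList xs ys) → xs ≡ ys
  eqList-sound {xs} {ys} t with LP.≡-dec ℕP._≟_ xs ys
  ... | yes xs≡ys = xs≡ys

  eqList-refl : ∀ xs → eqList xs xs ≡ true
  eqList-refl xs with LP.≡-dec ℕP._≟_ xs xs
  ... | yes _    = refl
  ... | no xs≢xs = ⊥-elim (xs≢xs refl)

  eqList-complete : ∀ {xs ys} → xs ≡ ys → T (eqList xs ys)
  eqList-complete {xs} refl = subst T (sym (eqList-refl xs)) tt

  eqList-∷ : ∀ a b xs ys → eqList (a ∷ xs) (b ∷ ys) ≡ (a ≡ᵇ b) ∧ eqList xs ys
  eqList-∷ a b xs ys = bool-ext {eqList (a ∷ xs) (b ∷ ys)} {(a ≡ᵇ b) ∧ eqList xs ys} forward backward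
    where
    forward : T (eqList (a ∷ xs) (b ∷ ys)) → T ((a ≡ᵇ b) ∧ eqList xs ys)
    forward t with eqList-sound {a ∷ xs} {b ∷ ys} t
    ... | refl = Equivalence.from T-∧ (ℕP.≡⇒≡ᵇ a a refl , eqList-complete {xs} refl)
    backward : T ((a ≡ᵇ b) ∧ eqList xs ys) → T (eqList (a ∷ xs) (b ∷ ys))
    backward t with Equivalence.to (T-∧ {a ≡ᵇ b}) t
    ... | a≡b , xs≡ys = eqList-complete (cong₂ _∷_ (ℕP.≡ᵇ⇒≡ a b a≡b) (eqList-sound {xs} {ys} xs≡ys))

  ΣList : ∀ {A : Set} → List A → (A → ℤ) → ℤ
  ΣList []       f = 0ℤ
  ΣList (x ∷ xs) f = f x + ΣList xs f

  ΣList-cong : ∀ {A : Set} (xs : List A) {f g : A → ℤ} → (∀ x → f x ≡ g x) → ΣList xs f ≡ ΣList xs g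
  ΣList-cong []       eq = refl
  ΣList-cong (x ∷ xs) eq = cong₂ _+_ (eq x) (ΣList-cong xs eq)

  ΣList-++ : ∀ {A : Set} (xs ys : List A) f → ΣList (xs ++ ys) f ≡ ΣList xs f + ΣList ys f
  ΣList-++ []       ys f = sym (ℤP.+-identityˡ _)
  ΣList-++ (x ∷ xs) ys f rewrite ΣList-++ xs ys f = sym (ℤP.+-assoc (f x) (ΣList xs f) (ΣList ys f))

  ΣList-map : ∀ {A B : Set} (h : A → B) (xs : List A) f → ΣList (map h xs) f ≡ ΣList xs (λ x → f (h x))
  ΣList-map h []       f = refl
  ΣList-map h (x ∷ xs) f = cong (f (h x) +_) (ΣList-map h xs f)

  ΣList-concatMap : ∀ {A B : Set} (h : A → List B) (xs : List A) f →
    ΣList (concatMap h xs) f ≡ ΣList xs (λ x → ΣList (h x) f)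
  ΣList-concatMap h []       f = refl
  ΣList-concatMap h (x ∷ xs) f =
    trans (ΣList-++ (h x) (concatMap h xs) f) (cong (ΣList (h x) f +_) (ΣList-concatMap h xs f))

  ΣList-+ : ∀ {A : Set} (xs : List A) f g → ΣList xs (λ x → f x + g x) ≡ ΣList xs f + ΣList xs g
  ΣList-+ []       f g = refl
  ΣList-+ (x ∷ xs) f g rewrite ΣList-+ xs f g = interchange (f x) (g x) (ΣList xs f) (ΣList xs g)
    where interchange : ∀ a b c d → (a + b) + (c + d) ≡ (a + c) + (b + d)
          interchange = solve-∀

  ΣList-*ˡ : ∀ {A : Set} (xs : List A) c f → c * ΣList xs f ≡ ΣList xs (λ x → c * f x)
  ΣList-*ˡ []       c f = ℤP.*-zeroʳ c
  ΣList-*ˡ (x ∷ xs) c f rewrite sym (ΣList-*ˡ xs c f) = ℤP.*-distribˡ-+ c (f x) (ΣList xs f)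

  ΣList-0 : ∀ {A : Set} (xs : List A) {f : A → ℤ} → (∀ x → f x ≡ 0ℤ) → ΣList xs f ≡ 0ℤ
  ΣList-0 []       eq = refl
  ΣList-0 (x ∷ xs) eq rewrite eq x | ΣList-0 xs eq = refl

  ΣList-swap : ∀ {A B : Set} (xs : List A) (ys : List B) (f : A → B → ℤ) →
    ΣList xs (λ x → ΣList ys (λ y → f x y)) ≡ ΣList ys (λ y → ΣList xs (λ x → f x y))
  ΣList-swap []       ys f = sym (ΣList-0 ys (λ _ → refl))
  ΣList-swap (x ∷ xs) ys f =
    trans (cong (ΣList ys (λ y → f x y) +_) (ΣList-swap xs ys f))
          (sym (ΣList-+ ys (λ y → f x y) (λ y → ΣList xs (λ x' → f x' y))))

  length-filter : ∀ {A : Set} {P : A → Set} (P? : ∀ x → Dec (P x)) (xs : List A) →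
    ℤ.+_ (length (filter P? xs)) ≡ ΣList xs (λ x → 𝟙 (does (P? x)))
  length-filter P? []       = refl
  length-filter P? (x ∷ xs) with does (P? x)
  ... | true  = cong (1ℤ +_) (length-filter P? xs)
  ... | false = trans (length-filter P? xs) (sym (ℤP.+-identityˡ _))

  Σ< : ℕ → (ℕ → ℤ) → ℤ
  Σ< N g = ΣList (upTo N) g

  Σ<-cong : ∀ N {g h : ℕ → ℤ} → (∀ c → g c ≡ h c) → Σ< N g ≡ Σ< N h
  Σ<-cong N eq = ΣList-cong (upTo N) eq

  Σ<-suc : ∀ N (g : ℕ → ℤ) → Σ< (suc N) g ≡ g 0 + Σ< N (λ c → g (suc c))
  Σ<-suc N g =
    cong (g 0 +_) (trans (cong (λ xs → ΣList xs g) (sym (LP.map-applyUpTo (λ x → x) suc N)))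
                         (ΣList-map suc (upTo N) g))

  Σ<-snoc : ∀ N (g : ℕ → ℤ) → Σ< (suc N) g ≡ Σ< N g + g N
  Σ<-snoc N g =
    trans (cong (λ xs → ΣList xs g) (sym (LP.applyUpTo-∷ʳ (λ x → x) N)))
          (trans (ΣList-++ (upTo N) (N ∷ []) g) (cong (Σ< N g +_) (ℤP.+-identityʳ (g N))))

  Σ<-cong-< : ∀ N {g h : ℕ → ℤ} → (∀ c → c < N → g c ≡ h c) → Σ< N g ≡ Σ< N h
  Σ<-cong-< zero    eq = refl
  Σ<-cong-< (suc N) {g} {h} eq =
    trans (Σ<-snoc N g)
          (trans (cong₂ _+_ (Σ<-cong-< N (λ c c<N → eq c (ℕP.m≤n⇒m≤1+n c<N))) (eq N ℕP.≤-refl))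
                 (sym (Σ<-snoc N h)))

  Σ<-0 : ∀ N {g : ℕ → ℤ} → (∀ c → c < N → g c ≡ 0ℤ) → Σ< N g ≡ 0ℤ
  Σ<-0 N eq = trans (Σ<-cong-< N eq) (ΣList-0 (upTo N) (λ _ → refl))

  Σ<-truncate : ∀ n k (g : ℕ → ℤ) → (∀ c → n ≤ c → g c ≡ 0ℤ) → Σ< (n ℕ.+ k) g ≡ Σ< n g
  Σ<-truncate n zero    g eq = cong (λ z → Σ< z g) (ℕP.+-identityʳ n)
  Σ<-truncate n (suc k) g eq =
    trans (cong (λ z → Σ< z g) (ℕP.+-suc n k))
          (trans (Σ<-snoc (n ℕ.+ k) g)
                 (trans (cong₂ _+_ (Σ<-truncate n k g eq) (eq (n ℕ.+ k) (ℕP.m≤m+n n k)))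
                        (ℤP.+-identityʳ _)))

  Σ<-sumTo : ∀ N (g : ℕ → ℤ) → Σ< (suc N) g ≡ sumTo N g
  Σ<-sumTo zero    g = ℤP.+-identityʳ (g 0)
  Σ<-sumTo (suc N) g = trans (Σ<-snoc (suc N) g) (cong (_+ g (suc N)) (Σ<-sumTo N g))

  Σ<-δ : ∀ N d (h : ℕ → ℤ) → d < N → Σ< N (λ c → δ c d * h c) ≡ h d
  Σ<-δ (suc N) d h (s≤s d≤N) = trans (Σ<-sumTo N _) (sumTo-δ N d h d≤N)

  Σ<-unique : ∀ N s₀ (g : ℕ → ℤ) → s₀ < N → g s₀ ≡ 1ℤ → (∀ s → s < N → s ≢ s₀ → g s ≡ 0ℤ) → Σ< N g ≡ 1ℤ
  Σ<-unique N s₀ g s₀<N g≡1 others = trans (Σ<-cong-< N asDelta) (Σ<-δ N s₀ (λ _ → 1ℤ) s₀<N)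
    where
    asDelta : ∀ s → s < N → g s ≡ δ s s₀ * 1ℤ
    asDelta s s<N with s ℕP.≟ s₀
    ... | yes refl = trans g≡1 (sym (cong (_* 1ℤ) (δ-same {s} refl)))
    ... | no s≢s₀  = trans (others s s<N s≢s₀) (sym (cong (_* 1ℤ) (δ-distinct s≢s₀)))

  ΣWords : ℕ → ℕ → (List ℕ → ℤ) → ℤ
  ΣWords m N f = ΣList (listsOver m (map suc (upTo N))) f

  ΣWords-zero : ∀ N f → ΣWords 0 N f ≡ f []
  ΣWords-zero N f = ℤP.+-identityʳ (f [])

  ΣWords-suc : ∀ m N f → ΣWords (suc m) N f ≡ Σ< N (λ c → ΣWords m N (λ τ → f (suc c ∷ τ)))
  ΣWords-suc m N f =
    trans (ΣList-concatMap (λ a → map (a ∷_) (listsOver m (map suc (upTo N)))) (map suc (upTo N)) f)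
    (trans (ΣList-cong (map suc (upTo N)) (λ a → ΣList-map (a ∷_) (listsOver m (map suc (upTo N))) f))
           (ΣList-map suc (upTo N) (λ a → ΣWords m N (λ τ → f (a ∷ τ)))))

  ΣWords-cong-length : ∀ m N {f g : List ℕ → ℤ} → (∀ σ → length σ ≡ m → f σ ≡ g σ) → ΣWords m N f ≡ ΣWords m N g
  ΣWords-cong-length zero    N eq = cong (_+ 0ℤ) (eq [] refl)
  ΣWords-cong-length (suc m) N {f} {g} eq =
    trans (ΣWords-suc m N f)
          (trans (Σ<-cong N (λ c → ΣWords-cong-length m N (λ τ e → eq (suc c ∷ τ) (cong suc e))))
                 (sym (ΣWords-suc m N g)))

  ΣWords-cong : ∀ m N {f g : List ℕ → ℤ} → (∀ σ → f σ ≡ g σ) → ΣWords m N f ≡ ΣWords m N g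
  ΣWords-cong m N eq = ΣList-cong (listsOver m (map suc (upTo N))) eq

  ΣWords-+ : ∀ m N f g → ΣWords m N (λ σ → f σ + g σ) ≡ ΣWords m N f + ΣWords m N g
  ΣWords-+ m N f g = ΣList-+ (listsOver m (map suc (upTo N))) f g

  ΣWords-*ˡ : ∀ m N c f → c * ΣWords m N f ≡ ΣWords m N (λ σ → c * f σ)
  ΣWords-*ˡ m N c f = ΣList-*ˡ (listsOver m (map suc (upTo N))) c f

  ΣWords-0 : ∀ m N {f : List ℕ → ℤ} → (∀ σ → length σ ≡ m → f σ ≡ 0ℤ) → ΣWords m N f ≡ 0ℤ
  ΣWords-0 m N eq = trans (ΣWords-cong-length m N eq) (ΣList-0 (listsOver m (map suc (upTo N))) (λ _ → refl))

  ΣWords-Σ< : ∀ m N k (g : ℕ → List ℕ → ℤ) → ΣWords m N (λ σ → Σ< k (λ c → g c σ)) ≡ Σ< k (λ c → ΣWords m N (g c))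
  ΣWords-Σ< m N k g = ΣList-swap (listsOver m (map suc (upTo N))) (upTo k) (λ σ c → g c σ)

  ΣWords-split : ∀ a b N f → ΣWords (a ℕ.+ b) N f ≡ ΣWords a N (λ u → ΣWords b N (λ v → f (u ++ v)))
  ΣWords-split zero    b N f = sym (ΣWords-zero N (λ u → ΣWords b N (λ v → f (u ++ v))))
  ΣWords-split (suc a) b N f =
    trans (ΣWords-suc (a ℕ.+ b) N f)
          (trans (Σ<-cong N (λ c → ΣWords-split a b N (λ τ → f (suc c ∷ τ))))
                 (sym (ΣWords-suc a N (λ u → ΣWords b N (λ v → f (u ++ v))))))

  ΣWords-select : ∀ v N (g : List ℕ → ℤ) → All (λ x → 1 ≤ x × x ≤ N) v →
    ΣWords (length v) N (λ v' → 𝟙 (eqList v' v) * g v') ≡ g v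
  ΣWords-select []          N g []                 = trans (ℤP.+-identityʳ _) (ℤP.*-identityˡ (g []))
  ΣWords-select (suc d ∷ v) N g ((_ , d<N) ∷ rest) =
    trans (ΣWords-suc (length v) N _)
    (trans (Σ<-cong N (λ c →
             trans (ΣWords-cong (length v) N (λ τ →
                      trans (cong (λ b → 𝟙 b * g (suc c ∷ τ)) (eqList-∷ (suc c) (suc d) τ v))
                            (trans (cong (_* g (suc c ∷ τ)) (𝟙-∧ (c ≡ᵇ d) (eqList τ v))) (ℤP.*-assoc (δ c d) _ _))))
                   (sym (ΣWords-*ˡ (length v) N (δ c d) _))))
    (trans (Σ<-δ N d _ d<N) (ΣWords-select v N (λ τ → g (suc d ∷ τ)) rest)))

  -- Weighted counts.  count m N n p is the number of words of length m over {1, …, N}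
  -- with weight (letter sum) n that satisfy p; with N = n it is the coefficient of
  -- x^n q^m in the generating function of the words satisfying p.

  count : ℕ → ℕ → ℕ → (List ℕ → Bool) → ℤ
  count m N n p = ΣWords m N (λ σ → 𝟙 (sum σ ≡ᵇ n) * 𝟙 (p σ))

  countPS : (List ℕ → Bool) → PS
  countPS p n m = count m n n p

  -- letters larger than the weight n never occur, so enlarging the alphabet beyond n
  -- does not change the count
  count-alphabet-+ : ∀ m n k p → count m (n ℕ.+ k) n p ≡ count m n n p
  count-alphabet-+ zero    n k p = refl
  count-alphabet-+ (suc m) n k p =
    trans (ΣWords-suc m (n ℕ.+ k) _)
    (trans (Σ<-truncate n k _ (λ c n≤c → ΣWords-0 m (n ℕ.+ k) (λ τ _ → tooHeavy c τ n≤c)))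
    (trans (Σ<-cong-< n (λ c c<n → trans (firstLetter (n ℕ.+ k) c c<n)
                                  (trans (restAlphabet c c<n k)
                                  (sym (trans (firstLetter n c c<n)
                                       (trans (cong (λ z → count m z (n ∸ suc c) (λ τ → p (suc c ∷ τ)))
                                                    (sym (ℕP.+-identityʳ n)))
                                              (restAlphabet c c<n 0)))))))
           (sym (ΣWords-suc m n _))))
    where
    tooHeavy : ∀ c τ → n ≤ c → 𝟙 (suc c ℕ.+ sum τ ≡ᵇ n) * 𝟙 (p (suc c ∷ τ)) ≡ 0ℤ
    tooHeavy c τ n≤c
      rewrite ≡ᵇ-false {suc c ℕ.+ sum τ} {n}
                (λ e → ℕP.<-irrefl (sym e) (ℕP.<-≤-trans (s≤s n≤c) (ℕP.m≤m+n (suc c) (sum τ)))) = refl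
    firstLetter : ∀ N c → c < n →
      ΣWords m N (λ τ → 𝟙 (suc c ℕ.+ sum τ ≡ᵇ n) * 𝟙 (p (suc c ∷ τ))) ≡ count m N (n ∸ suc c) (λ τ → p (suc c ∷ τ))
    firstLetter N c c<n =
      ΣWords-cong m N (λ τ → cong (λ b → 𝟙 b * 𝟙 (p (suc c ∷ τ))) (≡ᵇ-shift (suc c) (sum τ) n c<n))
    restAlphabet : ∀ c → c < n → ∀ k' →
      count m (n ℕ.+ k') (n ∸ suc c) (λ τ → p (suc c ∷ τ)) ≡ count m (n ∸ suc c) (n ∸ suc c) (λ τ → p (suc c ∷ τ))
    restAlphabet c c<n k' =
      trans (cong (λ z → count m z (n ∸ suc c) (λ τ → p (suc c ∷ τ)))
                  (trans (cong (ℕ._+ k') (sym (ℕP.m∸n+n≡m c<n))) (ℕP.+-assoc (n ∸ suc c) (suc c) k')))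
            (count-alphabet-+ m (n ∸ suc c) (suc c ℕ.+ k') (λ τ → p (suc c ∷ τ)))

  count-alphabet : ∀ m N n p → n ≤ N → count m N n p ≡ count m n n p
  count-alphabet m N n p n≤N =
    trans (cong (λ z → count m z n p) (sym (ℕP.m+[n∸m]≡n n≤N))) (count-alphabet-+ m n (N ∸ n) p)

  hasSuffix : List ℕ → List ℕ → Bool
  hasSuffix v σ = (length v ≤ᵇ length σ) ∧ eqList (drop (length σ ∸ length v) σ) v

  stem : List ℕ → List ℕ → List ℕ
  stem v σ = take (length σ ∸ length v) σ

  endsWith : List ℕ → (List ℕ → Bool) → List ℕ → Bool
  endsWith v p σ = hasSuffix v σ ∧ p (stem v σ)

  drop-++-length : ∀ (u w : List ℕ) → drop (length u) (u ++ w) ≡ w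
  drop-++-length []      w = refl
  drop-++-length (x ∷ u) w = drop-++-length u w

  take-++-length : ∀ (u w : List ℕ) → take (length u) (u ++ w) ≡ u
  take-++-length []      w = refl
  take-++-length (x ∷ u) w = cong (x ∷_) (take-++-length u w)

  endsWith-++ : ∀ v p (u v' : List ℕ) → length v' ≡ length v → endsWith v p (u ++ v') ≡ eqList v' v ∧ p u
  endsWith-++ v p u v' same =
    trans (cong (λ z → ((length v ≤ᵇ length (u ++ v')) ∧ eqList (drop z (u ++ v')) v) ∧ p (take z (u ++ v'))) stemLength)
    (trans (cong₂ (λ b w → (b ∧ eqList w v) ∧ p (take (length u) (u ++ v')))
                  (≤ᵇ-true (subst (length v ≤_) (sym (LP.length-++ u))
                              (subst (_≤ length u ℕ.+ length v') same (ℕP.m≤n+m (length v') (length u)))))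
                  (drop-++-length u v'))
           (cong (λ w → eqList v' v ∧ p w) (take-++-length u v')))
    where
    stemLength : length (u ++ v') ∸ length v ≡ length u
    stemLength = trans (cong (_∸ length v) (trans (LP.length-++ u) (cong (length u ℕ.+_) same)))
                       (ℕP.m+n∸n≡m (length u) (length v))

  count-endsWith-split : ∀ v p m N n → length v ≤ m →
    count m N n (endsWith v p) ≡
    ΣWords (m ∸ length v) N (λ u → ΣWords (length v) N (λ v' → 𝟙 (eqList v' v) * (𝟙 (sum u ℕ.+ sum v ≡ᵇ n) * 𝟙 (p u))))
  count-endsWith-split v p m N n |v|≤m =
    trans (cong (λ z → count z N n (endsWith v p)) (sym (ℕP.m∸n+n≡m |v|≤m)))
    (trans (ΣWords-split (m ∸ length v) (length v) N _)
           (ΣWords-cong (m ∸ length v) N (λ u → ΣWords-cong-length (length v) N (λ v' same → term u v' same))))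
    where
    onlyV : ∀ u v' b → eqList v' v ≡ b →
      𝟙 (sum (u ++ v') ≡ᵇ n) * (𝟙 b * 𝟙 (p u)) ≡ 𝟙 b * (𝟙 (sum u ℕ.+ sum v ≡ᵇ n) * 𝟙 (p u))
    onlyV u v' true  v'≡v with eqList-sound {v'} {v} (subst T (sym v'≡v) tt)
    ... | refl = trans (cong (λ z → 𝟙 (z ≡ᵇ n) * (1ℤ * 𝟙 (p u))) (sum-++ u v')) (swap1 (𝟙 (sum u ℕ.+ sum v' ≡ᵇ n)) (𝟙 (p u)))
      where swap1 : ∀ X Y → X * (1ℤ * Y) ≡ 1ℤ * (X * Y)
            swap1 = solve-∀
    onlyV u v' false _ = swap0 (𝟙 (sum (u ++ v') ≡ᵇ n)) (𝟙 (p u))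
      where swap0 : ∀ X Y → X * (0ℤ * Y) ≡ 0ℤ * (X * Y)
            swap0 = solve-∀
    term : ∀ u v' → length v' ≡ length v →
      𝟙 (sum (u ++ v') ≡ᵇ n) * 𝟙 (endsWith v p (u ++ v')) ≡ 𝟙 (eqList v' v) * (𝟙 (sum u ℕ.+ sum v ≡ᵇ n) * 𝟙 (p u))
    term u v' same =
      trans (cong (𝟙 (sum (u ++ v') ≡ᵇ n) *_) (trans (cong 𝟙 (endsWith-++ v p u v' same)) (𝟙-∧ (eqList v' v) (p u))))
            (onlyV u v' (eqList v' v) refl)

  count-endsWith : ∀ v p m n → All (1 ≤_) v →
    count m n n (endsWith v p) ≡ (mono 1ℤ (sum v) (length v) *PS countPS p) n m
  count-endsWith v p m n positive with length v ℕP.≤? m | sum v ℕP.≤? n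
  ... | yes |v|≤m | yes w≤n =
    trans (count-endsWith-split v p m n n |v|≤m)
    (trans (ΣWords-cong (m ∸ length v) n (λ u → ΣWords-select v n _ (lettersBounded v n positive w≤n)))
    (trans (ΣWords-cong (m ∸ length v) n (λ u → cong (λ b → 𝟙 b * 𝟙 (p u))
              (trans (cong (_≡ᵇ n) (ℕP.+-comm (sum u) (sum v))) (≡ᵇ-shift (sum v) (sum u) n w≤n))))
    (trans (count-alphabet (m ∸ length v) n (n ∸ sum v) p (ℕP.m∸n≤m n (sum v)))
           (sym (trans (mono-*-coeff 1ℤ (sum v) (length v) (countPS p) n m w≤n |v|≤m) (ℤP.*-identityˡ _))))))
    where
    lettersBounded : ∀ (v : List ℕ) n → All (1 ≤_) v → sum v ≤ n → All (λ x → 1 ≤ x × x ≤ n) v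
    lettersBounded []      n []       _   = []
    lettersBounded (x ∷ v) n (1≤x ∷ rest) w≤n =
      (1≤x , ℕP.≤-trans (ℕP.m≤m+n x (sum v)) w≤n) ∷ lettersBounded v n rest (ℕP.≤-trans (ℕP.m≤n+m (sum v) x) w≤n)
  ... | yes |v|≤m | no w≰n =
    trans (count-endsWith-split v p m n n |v|≤m)
    (trans (ΣWords-0 (m ∸ length v) n (λ u _ → ΣWords-0 (length v) n (λ v' _ → tooHeavy u v')))
           (sym (mono-*-coeff-vanish 1ℤ (sum v) (length v) (countPS p) n m (inj₁ (ℕP.≰⇒> w≰n)))))
    where
    tooHeavy : ∀ u v' → 𝟙 (eqList v' v) * (𝟙 (sum u ℕ.+ sum v ≡ᵇ n) * 𝟙 (p u)) ≡ 0ℤ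
    tooHeavy u v'
      rewrite ≡ᵇ-false {sum u ℕ.+ sum v} {n} (λ e → w≰n (subst (sum v ≤_) e (ℕP.m≤n+m (sum v) (sum u)))) =
      trans (cong (𝟙 (eqList v' v) *_) (ℤP.*-zeroˡ (𝟙 (p u)))) (ℤP.*-zeroʳ (𝟙 (eqList v' v)))
  ... | no |v|≰m | _ =
    trans (ΣWords-0 m n tooShort)
          (sym (mono-*-coeff-vanish 1ℤ (sum v) (length v) (countPS p) n m (inj₂ (ℕP.≰⇒> |v|≰m))))
    where
    tooShort : ∀ σ → length σ ≡ m → 𝟙 (sum σ ≡ᵇ n) * 𝟙 (endsWith v p σ) ≡ 0ℤ
    tooShort σ |σ|≡m rewrite ≤ᵇ-false {length v} {length σ} (subst (_< length v) (sym |σ|≡m) (ℕP.≰⇒> |v|≰m)) =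
      ℤP.*-zeroʳ (𝟙 (sum σ ≡ᵇ n))

  ΣWords-ΣFinℤ : ∀ {k} m N (g : Fin k → List ℕ → ℤ) →
    ΣWords m N (λ σ → ΣFinℤ (λ j → g j σ)) ≡ ΣFinℤ (λ j → ΣWords m N (g j))
  ΣWords-ΣFinℤ {zero}  m N g = ΣWords-0 m N (λ _ _ → refl)
  ΣWords-ΣFinℤ {suc k} m N g =
    trans (ΣWords-+ m N (g zero) (λ σ → ΣFinℤ (λ j → g (suc j) σ)))
          (cong (ΣWords m N (g zero) +_) (ΣWords-ΣFinℤ m N (λ j → g (suc j))))

  count-combination : ∀ {k} ℓ m n (B : Fin k → ℕ → Bool) (P : Fin k → ℕ → List ℕ → Bool) →
    ΣFinℤ (λ j → Σ< ℓ (λ s → 𝟙 (B j s) * count m n n (P j s))) ≡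
    ΣWords m n (λ σ → 𝟙 (sum σ ≡ᵇ n) * ΣFinℤ (λ j → Σ< ℓ (λ s → 𝟙 (B j s) * 𝟙 (P j s σ))))
  count-combination ℓ m n B P = sym
    (trans (ΣWords-cong m n (λ σ →
              trans (ΣFinℤ-*ˡ (𝟙 (sum σ ≡ᵇ n)) (λ j → Σ< ℓ (λ s → 𝟙 (B j s) * 𝟙 (P j s σ))))
                    (ΣFinℤ-cong (λ j → trans (ΣList-*ˡ (upTo ℓ) (𝟙 (sum σ ≡ᵇ n)) (λ s → 𝟙 (B j s) * 𝟙 (P j s σ)))
                                            (Σ<-cong ℓ (λ s → exchange (𝟙 (sum σ ≡ᵇ n)) (𝟙 (B j s)) (𝟙 (P j s σ))))))))
    (trans (ΣWords-ΣFinℤ m n (λ j σ → Σ< ℓ (λ s → 𝟙 (B j s) * (𝟙 (sum σ ≡ᵇ n) * 𝟙 (P j s σ)))))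
           (ΣFinℤ-cong (λ j → trans (ΣWords-Σ< m n ℓ (λ s σ → 𝟙 (B j s) * (𝟙 (sum σ ≡ᵇ n) * 𝟙 (P j s σ))))
                                    (Σ<-cong ℓ (λ s → sym (ΣWords-*ˡ m n (𝟙 (B j s)) (λ σ → 𝟙 (sum σ ≡ᵇ n) * 𝟙 (P j s σ)))))))))
    where
    exchange : ∀ x y z → x * (y * z) ≡ y * (x * z)
    exchange = solve-∀

module Factors where

  open WordSums using (eqList; eqList-sound; eqList-complete; hasSuffix; stem; ≤ᵇ-true; drop-++-length; take-++-length)
  open import Data.Nat as ℕ using (ℕ; zero; suc; _∸_; _≤_; _<_; s≤s; _≤ᵇ_)
  open import Data.Nat.Properties as ℕP using ()
  open import Data.List using (List; []; _∷_; _++_; length; take; drop)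
  open import Data.List.Properties as LP using ()
  open import Data.List.Relation.Binary.Infix.Heterogeneous using (here; there; _++ⁱ_; _ⁱ++_)
  open import Data.List.Relation.Binary.Infix.Heterogeneous.Properties using (fromPointwise)
  open import Data.List.Relation.Binary.Prefix.Heterogeneous using (Prefix; []; _∷_)
  open import Data.List.Relation.Binary.Pointwise.Properties as PointwiseP using ()
  open import Data.Fin using (Fin; zero; suc)
  open import Data.Bool using (Bool; T)
  open import Data.Bool.Properties using (T-∧)
  open import Function.Bundles using (Equivalence)
  open import Relation.Binary.PropositionalEquality
  open import Relation.Nullary using (yes; no; ¬_)
  open import Data.Empty using (⊥-elim)
  open import Data.Unit using (tt)
  open import Data.Product using (_,_; _×_; proj₂; Σ-syntax)
  open import Data.Sum using (_⊎_; inj₁; inj₂)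

  occurs-refl : ∀ t → t occursIn t
  occurs-refl t = fromPointwise (PointwiseP.refl refl)

  occurs-suffix : ∀ d t → t occursIn (d ++ t)
  occurs-suffix d t = d ++ⁱ occurs-refl t

  occurs-++ʳ : ∀ {t x} → t occursIn x → ∀ z → t occursIn (x ++ z)
  occurs-++ʳ t∈x z = t∈x ⁱ++ z

  prefix-snoc : ∀ {t : List ℕ} (u : List ℕ) a → Prefix _≡_ t (u ++ a ∷ []) → Prefix _≡_ t u ⊎ t ≡ u ++ a ∷ []
  prefix-snoc []      a []             = inj₁ []
  prefix-snoc []      a (refl ∷ [])    = inj₂ refl
  prefix-snoc (x ∷ u) a []             = inj₁ []
  prefix-snoc (x ∷ u) a (refl ∷ t≤u+a) with prefix-snoc u a t≤u+a
  ... | inj₁ t≤u = inj₁ (refl ∷ t≤u)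
  ... | inj₂ t≡u = inj₂ (cong (x ∷_) t≡u)

  fromPrefix : ∀ {t : List ℕ} (u : List ℕ) a → Prefix _≡_ t (u ++ a ∷ []) →
    t occursIn u ⊎ Σ[ w ∈ List ℕ ] u ++ a ∷ [] ≡ w ++ t
  fromPrefix u a t≤u+a with prefix-snoc u a t≤u+a
  ... | inj₁ t≤u = inj₁ (here t≤u)
  ... | inj₂ t≡u = inj₂ ([] , sym t≡u)

  occurs-snoc : ∀ {t : List ℕ} (u : List ℕ) a → t occursIn (u ++ a ∷ []) →
    t occursIn u ⊎ Σ[ w ∈ List ℕ ] u ++ a ∷ [] ≡ w ++ t
  occurs-snoc []      a (here t≤a)      = fromPrefix [] a t≤a
  occurs-snoc []      a (there (here [])) = inj₁ (here [])
  occurs-snoc (x ∷ u) a (here t≤u+a)    = fromPrefix (x ∷ u) a t≤u+a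
  occurs-snoc (x ∷ u) a (there t∈u+a) with occurs-snoc u a t∈u+a
  ... | inj₁ t∈u      = inj₁ (there t∈u)
  ... | inj₂ (w , eq) = inj₂ (x ∷ w , cong (x ∷_) eq)

  ++-suffix : ∀ (w t w' t' : List ℕ) → w ++ t ≡ w' ++ t' → length t ≤ length t' → Σ[ d ∈ List ℕ ] t' ≡ d ++ t
  ++-suffix w       t []       t' eq _ = w , sym eq
  ++-suffix []      t (y ∷ w') t' eq t≤t' =
    ⊥-elim (ℕP.<-irrefl refl (ℕP.≤-trans (s≤s (ℕP.m≤n+m (length t') (length w')))
      (subst (_≤ length t') (trans (cong length eq) (cong suc (LP.length-++ w'))) t≤t')))
  ++-suffix (x ∷ w) t (y ∷ w') t' eq t≤t' = ++-suffix w t w' t' (LP.∷-injectiveʳ eq) t≤t'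

  ++-prefix : ∀ (u v u' v' : List ℕ) → u ++ v ≡ u' ++ v' → length u' ≤ length u → Σ[ e ∈ List ℕ ] u ≡ u' ++ e
  ++-prefix u       v []       v' eq _          = u , refl
  ++-prefix (x ∷ u) v (y ∷ u') v' eq (s≤s u'≤u) with LP.∷-injective eq
  ... | refl , eq' = let (e , u≡u'e) = ++-prefix u v u' v' eq' u'≤u in e , cong (x ∷_) u≡u'e

  ++-equal-length : ∀ (u v u' v' : List ℕ) → u ++ v ≡ u' ++ v' → length u ≡ length u' → u ≡ u'
  ++-equal-length []      v []       v' eq _    = refl
  ++-equal-length (x ∷ u) v (y ∷ u') v' eq same with LP.∷-injective eq
  ... | refl , eq' = cong (x ∷_) (++-equal-length u v u' v' eq' (ℕP.suc-injective same))

  length-++-≡ : ∀ {σ : List ℕ} u v → σ ≡ u ++ v → length σ ≡ length u ℕ.+ length v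
  length-++-≡ u v refl = LP.length-++ u

  take-nonempty : ∀ p (a : List ℕ) → 1 ≤ p → p ≤ length a → Σ[ y ∈ ℕ ] Σ[ ys ∈ List ℕ ] take p a ≡ y ∷ ys
  take-nonempty (suc p) (y ∷ a) _ _ = y , take p a , refl

  init : List ℕ → List ℕ
  init σ = take (length σ ∸ 1) σ

  init-snoc : ∀ (τ : List ℕ) a → init (τ ++ a ∷ []) ≡ τ
  init-snoc τ a =
    trans (cong (λ z → take (z ∸ 1) (τ ++ a ∷ [])) (trans (LP.length-++ τ) (ℕP.+-comm (length τ) 1)))
          (take-++-length τ (a ∷ []))

  init-++ : ∀ (x : List ℕ) y ys → init (x ++ y ∷ ys) ≡ x ++ init (y ∷ ys)
  init-++ []      y ys = refl
  init-++ (z ∷ x) y ys =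
    trans (cong (λ n → take n (z ∷ x ++ y ∷ ys)) len)
          (cong (z ∷_) (trans (cong (λ n → take n (x ++ y ∷ ys)) (sym (cong (_∸ 1) len))) (init-++ x y ys)))
    where
    len : length (x ++ y ∷ ys) ≡ suc (length x ℕ.+ length ys)
    len = trans (LP.length-++ x) (ℕP.+-suc (length x) (length ys))

  hasSuffix-sound : ∀ v σ → T (hasSuffix v σ) → σ ≡ stem v σ ++ v
  hasSuffix-sound v σ t =
    trans (sym (LP.take++drop≡id (length σ ∸ length v) σ))
          (cong (stem v σ ++_) (eqList-sound (proj₂ (Equivalence.to (T-∧ {length v ≤ᵇ length σ}) t))))

  hasSuffix-complete : ∀ v σ u → σ ≡ u ++ v → T (hasSuffix v σ) × stem v σ ≡ u
  hasSuffix-complete v .(u ++ v) u refl = isSuffix , stem≡u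
    where
    stemLength : length (u ++ v) ∸ length v ≡ length u
    stemLength = trans (cong (_∸ length v) (LP.length-++ u)) (ℕP.m+n∸n≡m (length u) (length v))
    isSuffix : T (hasSuffix v (u ++ v))
    isSuffix = Equivalence.from T-∧
      ( subst T (sym (≤ᵇ-true (subst (length v ≤_) (sym (LP.length-++ u)) (ℕP.m≤n+m (length v) (length u))))) tt
      , subst (λ z → T (eqList (drop z (u ++ v)) v)) (sym stemLength)
          (subst (λ w → T (eqList w v)) (sym (drop-++-length u v)) (eqList-complete {v} refl)) )
    stem≡u : stem v (u ++ v) ≡ u
    stem≡u = trans (cong (λ z → take z (u ++ v)) stemLength) (take-++-length u v)

  prefix-take : ∀ l (a : List ℕ) → Prefix _≡_ (take l a) a
  prefix-take zero    a       = []
  prefix-take (suc l) []      = []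
  prefix-take (suc l) (x ∷ a) = refl ∷ prefix-take l a

  occurs-take-drop : ∀ l k (a : List ℕ) → take l (drop k a) occursIn a
  occurs-take-drop l zero    a       = here (prefix-take l a)
  occurs-take-drop l (suc k) []      = subst (_occursIn []) (sym (LP.take-[] l)) (here [])
  occurs-take-drop l (suc k) (x ∷ a) = there (occurs-take-drop l k a)

  avoids-sound : ∀ {k} (S : Fin k → List ℕ) s → T (avoidsAll? S s) → ∀ j → ¬ (S j occursIn s)
  avoids-sound {suc k} S s t j occ with S zero occursIn? s
  avoids-sound {suc k} S s t zero    occ | no ¬occ = ¬occ occ
  avoids-sound {suc k} S s t (suc j) occ | no _    = avoids-sound (λ j → S (suc j)) s t j occ

  avoids-complete : ∀ {k} (S : Fin k → List ℕ) s → (∀ j → ¬ (S j occursIn s)) → T (avoidsAll? S s)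
  avoids-complete {zero}  S s _     = tt
  avoids-complete {suc k} S s avoid with S zero occursIn? s
  ... | yes occ = avoid zero occ
  ... | no _    = avoids-complete (λ j → S (suc j)) s (λ j → avoid (suc j))

  avoids-fails : ∀ {k} (S : Fin k → List ℕ) s → ¬ T (avoidsAll? S s) → Σ[ j ∈ Fin k ] S j occursIn s
  avoids-fails {zero}  S s fails = ⊥-elim (fails tt)
  avoids-fails {suc k} S s fails with S zero occursIn? s
  ... | yes occ = zero , occ
  ... | no _    = let (j , occ) = avoids-fails (λ j → S (suc j)) s fails in suc j , occ

  avoids-prefix : ∀ {k} (S : Fin k → List ℕ) x y → T (avoidsAll? S (x ++ y)) → T (avoidsAll? S x)
  avoids-prefix S x y t = avoids-complete S x (λ j occ → avoids-sound S (x ++ y) t j (occurs-++ʳ occ y))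

  -- Correlation bits.  When b is not a proper factor of a, the t-th correlation bit of a
  -- against b says exactly that the first |a|−t letters of a are the last |a|−t letters of b.
  corrBit-sound : ∀ a b t → T (corrBit a b t) → (length b < length a → ¬ (b occursIn a)) →
    (length a ∸ t ≤ length b) × take (length a ∸ t) a ≡ drop (length b ∸ (length a ∸ t)) b
  corrBit-sound a b t bit noFactor with length a ℕP.≤? length b
  ... | yes a≤b = ℕP.≤-trans (ℕP.m∸n≤m _ t) a≤b , eqList-sound bit
  ... | no a≰b with t ℕP.≤? (length a ∸ length b)
  ...   | yes _ = ⊥-elim (noFactor (ℕP.≰⇒> a≰b)
                    (subst (_occursIn a) (sym (eqList-sound {b} bit)) (occurs-take-drop (length b) (length a ∸ length b ∸ t) a)))
  ...   | no t≰ = overlapFits , eqList-sound bit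
    where
    overlapFits : length a ∸ t ≤ length b
    overlapFits = subst (length a ∸ t ≤_) (ℕP.m∸[m∸n]≡n (ℕP.<⇒≤ (ℕP.≰⇒> a≰b)))
                        (ℕP.∸-monoʳ-≤ (length a) (ℕP.<⇒≤ (ℕP.≰⇒> t≰)))

  corrBit-complete : ∀ a b t → length a ∸ t ≤ length b → take (length a ∸ t) a ≡ drop (length b ∸ (length a ∸ t)) b →
    (length b < length a → ¬ (b occursIn a)) → T (corrBit a b t)
  corrBit-complete a b t fits agree noFactor with length a ℕP.≤? length b
  ... | yes _ = eqList-complete agree
  ... | no a≰b with t ℕP.≤? (length a ∸ length b)
  ...   | no _ = eqList-complete agree
  ...   | yes t≤ = ⊥-elim (noFactor (ℕP.≰⇒> a≰b) (subst (_occursIn a) prefixIsB (here (prefix-take (length b) a))))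
    where
    exact : length a ∸ t ≡ length b
    exact = ℕP.≤-antisym fits (subst (_≤ length a ∸ t) (ℕP.m∸[m∸n]≡n (ℕP.<⇒≤ (ℕP.≰⇒> a≰b))) (ℕP.∸-monoʳ-≤ (length a) t≤))
    prefixIsB : take (length b) a ≡ b
    prefixIsB = trans (cong (λ z → take z a) (sym exact))
                      (trans agree (cong (λ z → drop z b) (trans (cong (length b ∸_) exact) (ℕP.n∸n≡0 (length b)))))

module Correlation where

  open PowerSeries
  open WordSums
  open import Data.Nat as ℕ using (ℕ; zero; suc; _∸_)
  open import Data.Nat.Properties as ℕP using ()
  open import Data.Nat.ListAction using (sum)
  open import Data.Integer using (ℤ; 1ℤ; _+_; _*_)
  open import Data.Integer.Properties as ℤP using ()
  open import Data.List using (List; length; drop)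
  open import Data.Bool using (true; false; if_then_else_)
  open import Algebra.Bundles using (CommutativeRing)
  open import Relation.Binary.PropositionalEquality

  private module R = CommutativeRing PSRing

  corrMonomial : List ℕ → ℕ → PS
  corrMonomial a t = mono 1ℤ (sum (drop (length a ∸ t) a)) t

  corrPolyFrom-*-coeff : ∀ a b t r (F : PS) n m →
    (corrPolyFrom a b t r *PS F) n m ≡ Σ< r (λ s → 𝟙 (corrBit a b (t ℕ.+ s)) * (corrMonomial a (t ℕ.+ s) *PS F) n m)
  corrPolyFrom-*-coeff a b t zero    F n m = R.zeroˡ F n m
  corrPolyFrom-*-coeff a b t (suc r) F n m =
    trans (R.distribʳ F leading (corrPolyFrom a b (suc t) r) n m)
    (trans (cong₂ _+_ (leadingTerm (corrBit a b t))
                      (trans (corrPolyFrom-*-coeff a b (suc t) r F n m) (Σ<-cong r (λ s → cong term (sym (ℕP.+-suc t s))))))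
           (sym (trans (Σ<-suc r (λ s → term (t ℕ.+ s)))
                       (cong (_+ Σ< r (λ s → term (t ℕ.+ suc s))) (cong term (ℕP.+-identityʳ t))))))
    where
    term : ℕ → ℤ
    term z = 𝟙 (corrBit a b z) * (corrMonomial a z *PS F) n m
    leading : PS
    leading = if corrBit a b t then corrMonomial a t else 0PS
    leadingTerm : ∀ bit → ((if bit then corrMonomial a t else 0PS) *PS F) n m ≡ 𝟙 bit * (corrMonomial a t *PS F) n m
    leadingTerm true  = sym (ℤP.*-identityˡ _)
    leadingTerm false = R.zeroˡ F n m

module Avoidance {k} (S : Fin k → List ℕ) (distinct : ∀ i j → i ≢ j → ¬ (S i occursIn S j)) where

  open FiniteSums
  open WordSums
  open Factors
  open import Data.Nat as ℕ using (zero; suc; _∸_; _≤_; _<_; z≤n; s≤s)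
  open import Data.Nat.Properties as ℕP using ()
  open import Data.Integer as ℤ using (ℤ; 1ℤ; _+_)
  open import Data.Integer.Properties as ℤP using ()
  open import Data.List using ([]; _∷_; _++_; length; take; drop)
  open import Data.List.Properties as LP using ()
  open import Data.Fin as F using (zero; suc)
  open import Data.Bool using (Bool; true; false; _∧_; T)
  open import Data.Bool.Properties using (T-∧)
  open import Function.Bundles using (Equivalence)
  open import Relation.Binary.PropositionalEquality
  open import Relation.Binary.Definitions using (tri<; tri≈; tri>)
  open import Relation.Nullary using (yes; no)
  open import Data.Empty using (⊥; ⊥-elim)
  open import Data.Unit using (tt)
  open import Data.Product using (_,_; _×_; proj₁; proj₂; Σ-syntax)
  open import Data.Sum using (inj₁; inj₂)

  ∧-intro : ∀ {x y} → T x → T y → T (x ∧ y)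
  ∧-intro tx ty = Equivalence.from T-∧ (tx , ty)

  ∧-elim : ∀ x {y} → T (x ∧ y) → T x × T y
  ∧-elim x = Equivalence.to (T-∧ {x})

  avoids : List ℕ → Bool
  avoids = avoidsAll? S

  -- σ ends with S j and this is the first forbidden factor of σ: σ without its last
  -- letter avoids every S j
  firstHitBy : Fin k → List ℕ → Bool
  firstHitBy j σ = hasSuffix (S j) σ ∧ avoids (init σ)

  -- two members of the family ending the same word coincide, since the shorter one
  -- would be a factor of the longer one
  suffix-index-unique : ∀ j j' w w' → w ++ S j ≡ w' ++ S j' → j ≡ j'
  suffix-index-unique j j' w w' eq with j F.≟ j'
  ... | yes j≡j' = j≡j'
  ... | no j≢j' with ℕP.≤-total (length (S j)) (length (S j'))
  ...   | inj₁ shorter = let (d , S'≡dS) = ++-suffix w (S j) w' (S j') eq shorter in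
    ⊥-elim (distinct j j' j≢j' (subst (S j occursIn_) (sym S'≡dS) (occurs-suffix d (S j))))
  ...   | inj₂ longer = let (d , S≡dS') = ++-suffix w' (S j') w (S j) (sym eq) longer in
    ⊥-elim (distinct j' j (λ e → j≢j' (sym e)) (subst (S j' occursIn_) (sym S≡dS') (occurs-suffix d (S j'))))

  firstHit-unique : ∀ j j' σ → T (firstHitBy j σ) → T (firstHitBy j' σ) → j ≡ j'
  firstHit-unique j j' σ hit hit' =
    suffix-index-unique j j' (stem (S j) σ) (stem (S j') σ)
      (trans (sym (hasSuffix-sound (S j) σ (proj₁ (∧-elim _ hit)))) (hasSuffix-sound (S j') σ (proj₁ (∧-elim _ hit'))))

  noHit-whileAvoiding : ∀ j σ → T (avoids σ) → ¬ T (firstHitBy j σ)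
  noHit-whileAvoiding j σ av hit =
    avoids-sound S σ av j
      (subst (S j occursIn_) (sym (hasSuffix-sound (S j) σ (proj₁ (∧-elim _ hit)))) (occurs-suffix _ (S j)))

  noHit-afterViolation : ∀ j τ a → ¬ T (avoids τ) → ¬ T (firstHitBy j (τ ++ a ∷ []))
  noHit-afterViolation j τ a ¬av hit =
    ¬av (subst (λ z → T (avoids z)) (init-snoc τ a) (proj₂ (∧-elim (hasSuffix (S j) (τ ++ a ∷ [])) hit)))

  newOccurrence : ∀ τ a → T (avoids τ) → ¬ T (avoids (τ ++ a ∷ [])) →
    Σ[ j ∈ Fin k ] Σ[ w ∈ List ℕ ] τ ++ a ∷ [] ≡ w ++ S j
  newOccurrence τ a av ¬av with avoids-fails S (τ ++ a ∷ []) ¬av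
  ... | j , occ with occurs-snoc τ a occ
  ...   | inj₁ occτ      = ⊥-elim (avoids-sound S τ av j occτ)
  ...   | inj₂ (w , eq)  = j , w , eq

  firstHit-new : ∀ τ a j w → T (avoids τ) → τ ++ a ∷ [] ≡ w ++ S j → T (firstHitBy j (τ ++ a ∷ []))
  firstHit-new τ a j w av eq =
    ∧-intro (proj₁ (hasSuffix-complete (S j) (τ ++ a ∷ []) w eq)) (subst (λ z → T (avoids z)) (sym (init-snoc τ a)) av)

  append-letter : ∀ τ a → 𝟙 (avoids (τ ++ a ∷ [])) + ΣFinℤ (λ j → 𝟙 (firstHitBy j (τ ++ a ∷ []))) ≡ 𝟙 (avoids τ)
  append-letter τ a with avoids τ in eτ | avoids (τ ++ a ∷ []) in eτa
  ... | false | true  = ⊥-elim (subst T eτ (avoids-prefix S τ (a ∷ []) (subst T (sym eτa) tt)))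
  ... | false | false =
    trans (ℤP.+-identityˡ _)
          (ΣFinℤ-0 _ (λ j → 𝟙-false (noHit-afterViolation j τ a (λ t → subst T eτ t))))
  ... | true  | true  =
    cong (1ℤ +_) (ΣFinℤ-0 _ (λ j → 𝟙-false (noHit-whileAvoiding j (τ ++ a ∷ []) (subst T (sym eτa) tt))))
  ... | true  | false =
    let av = subst T (sym eτ) tt
        (j₀ , w , eq) = newOccurrence τ a av (λ t → subst T eτa t)
        hit₀ = firstHit-new τ a j₀ w av eq in
    trans (ℤP.+-identityˡ _)
          (ΣFinℤ-unique _ j₀ (𝟙-true hit₀)
             (λ j j≢j₀ → 𝟙-false (λ hit → j≢j₀ (firstHit-unique j j₀ (τ ++ a ∷ []) hit hit₀))))

  firstViolation : ∀ ρ τ → T (avoids τ) → ¬ T (avoids (τ ++ ρ)) →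
    Σ[ ρ₁ ∈ List ℕ ] Σ[ y ∈ ℕ ] Σ[ ρ₂ ∈ List ℕ ]
      (ρ ≡ ρ₁ ++ y ∷ ρ₂) × T (avoids (τ ++ ρ₁)) × ¬ T (avoids ((τ ++ ρ₁) ++ y ∷ []))
  firstViolation []      τ av ¬av = ⊥-elim (¬av (subst (λ z → T (avoids z)) (sym (LP.++-identityʳ τ)) av))
  firstViolation (y ∷ ρ) τ av ¬av with avoids (τ ++ y ∷ []) in eq
  ... | false =
    [] , y , ρ , refl , subst (λ z → T (avoids z)) (sym (LP.++-identityʳ τ)) av ,
    (λ t → subst T eq (subst (λ z → T (avoids z)) (cong (_++ y ∷ []) (LP.++-identityʳ τ)) t))
  ... | true =
    let (ρ₁ , y' , ρ₂ , ρ≡ , av₁ , ¬av₁) =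
          firstViolation ρ (τ ++ y ∷ []) (subst T (sym eq) tt)
            (λ t → ¬av (subst (λ z → T (avoids z)) (LP.++-assoc τ (y ∷ []) ρ) t))
    in y ∷ ρ₁ , y' , ρ₂ , cong (y ∷_) ρ≡ ,
       subst (λ z → T (avoids z)) (LP.++-assoc τ (y ∷ []) ρ₁) av₁ ,
       (λ t → ¬av₁ (subst (λ z → T (avoids z)) (cong (_++ y' ∷ []) (sym (LP.++-assoc τ (y ∷ []) ρ₁))) t))

  noEarlierHit : ∀ u u' y ys j' w' → u ≡ u' ++ y ∷ ys → T (avoids (init u)) → u' ≡ w' ++ S j' → ⊥
  noEarlierHit u u' y ys j' w' u≡ avInit u'≡ =
    avoids-sound S u'
      (avoids-prefix S u' (init (y ∷ ys))
         (subst (λ z → T (avoids z)) (trans (cong init u≡) (init-++ u' y ys)) avInit)) j'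
      (subst (S j' occursIn_) (sym u'≡) (occurs-suffix w' (S j')))

  -- A word τ a with τ avoiding the family is
  -- decomposed at its first forbidden factor: it is  u · (the last s letters of a),  where
  -- u is first hit by some S j, s < ℓ(a), and S j overlaps a in the way recorded by the s-th
  -- correlation bit of a against S j.
  module Overlaps (i : Fin k) where

    a : List ℕ
    a = S i

    ℓ : ℕ
    ℓ = length a

    lastLetters : ℕ → List ℕ
    lastLetters s = drop (ℓ ∸ s) a

    length-lastLetters : ∀ s → s < ℓ → length (lastLetters s) ≡ s
    length-lastLetters s s<ℓ =
      trans (LP.length-drop (ℓ ∸ s) a) (ℕP.m∸[m∸n]≡n (ℕP.<⇒≤ s<ℓ))

    Overlap : Fin k → ℕ → List ℕ → Bool
    Overlap j s σ = corrBit a (S j) s ∧ endsWith (lastLetters s) (firstHitBy j) σ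

    notProperFactor : ∀ j → length (S j) < ℓ → ¬ (S j occursIn a)
    notProperFactor j shorter occ with j F.≟ i
    ... | yes refl = ℕP.<-irrefl refl shorter
    ... | no j≢i   = distinct j i j≢i occ

    record Decomposition (j : Fin k) (s : ℕ) (σ : List ℕ) : Set where
      field
        u w         : List ℕ
        σ≡          : σ ≡ u ++ lastLetters s
        u≡          : u ≡ w ++ S j
        initAvoids  : T (avoids (init u))
        fits        : ℓ ∸ s ≤ length (S j)
        agree       : take (ℓ ∸ s) a ≡ drop (length (S j) ∸ (ℓ ∸ s)) (S j)

    decompose : ∀ j s σ → T (Overlap j s σ) → Decomposition j s σ
    decompose j s σ t =
      let (bit , ends)    = ∧-elim (corrBit a (S j) s) t
          (suffix , hitU) = ∧-elim (hasSuffix (lastLetters s) σ) ends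
          u               = stem (lastLetters s) σ
          (suffixJ , av)  = ∧-elim (hasSuffix (S j) u) hitU
          (fits , agree)  = corrBit-sound a (S j) s bit (notProperFactor j)
      in record { u = u ; w = stem (S j) u ; σ≡ = hasSuffix-sound (lastLetters s) σ suffix
                ; u≡ = hasSuffix-sound (S j) u suffixJ ; initAvoids = av ; fits = fits ; agree = agree }

    overlap⇒endsWith : ∀ j s σ → s < ℓ → T (Overlap j s σ) → T (endsWith a avoids σ)
    overlap⇒endsWith j s σ s<ℓ t =
      ∧-intro (proj₁ stemIsτ) (subst (λ z → T (avoids z)) (sym (proj₂ stemIsτ)) τAvoids)
      where
      open Decomposition (decompose j s σ t)
      p = ℓ ∸ s
      d = take (length (S j) ∸ p) (S j)
      Sj≡ : S j ≡ d ++ take p a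
      Sj≡ = trans (sym (LP.take++drop≡id (length (S j) ∸ p) (S j))) (cong (d ++_) (sym agree))
      u≡' : u ≡ (w ++ d) ++ take p a
      u≡' = trans u≡ (trans (cong (w ++_) Sj≡) (sym (LP.++-assoc w d (take p a))))
      σ≡' : σ ≡ (w ++ d) ++ a
      σ≡' = trans σ≡ (trans (cong (_++ lastLetters s) u≡')
                     (trans (LP.++-assoc (w ++ d) (take p a) (lastLetters s))
                            (cong ((w ++ d) ++_) (LP.take++drop≡id p a))))
      stemIsτ = hasSuffix-complete a σ (w ++ d) σ≡'
      -- the overlap  take p a  is nonempty, so  w d  is a prefix of  init u
      τAvoids : T (avoids (w ++ d))
      τAvoids =
        let (y , ys , eq) = take-nonempty p a (ℕP.m<n⇒0<n∸m s<ℓ) (ℕP.m∸n≤m ℓ s) in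
        avoids-prefix S (w ++ d) (init (y ∷ ys))
          (subst (λ z → T (avoids z)) (trans (cong init (trans u≡' (cong ((w ++ d) ++_) eq))) (init-++ (w ++ d) y ys))
                 initAvoids)

    -- Two overlaps of the same word coincide: a shorter last part s' > s would place an
    -- earlier hit strictly inside the first-hit word of the other decomposition.
    overlap-earlier-absurd : ∀ j j' s s' σ → s < ℓ → s' < ℓ → s < s' → T (Overlap j s σ) → T (Overlap j' s' σ) → ⊥
    overlap-earlier-absurd j j' s s' σ s<ℓ s'<ℓ s<s' t t' = strictPrefix rest u≡u'rest
      where
      module D  = Decomposition (decompose j s σ t)
      module D' = Decomposition (decompose j' s' σ t')
      sameLength : length D.u ℕ.+ s ≡ length D'.u ℕ.+ s'
      sameLength =
        trans (cong (length D.u ℕ.+_) (sym (length-lastLetters s s<ℓ)))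
        (trans (sym (length-++-≡ D.u (lastLetters s) D.σ≡))
        (trans (length-++-≡ D'.u (lastLetters s') D'.σ≡) (cong (length D'.u ℕ.+_) (length-lastLetters s' s'<ℓ))))
      u'<u : length D'.u < length D.u
      u'<u with length D'.u ℕP.<? length D.u
      ... | yes lt = lt
      ... | no ¬lt = ⊥-elim (ℕP.<-irrefl sameLength (ℕP.+-mono-≤-< (ℕP.≮⇒≥ ¬lt) s<s'))
      prefixSplit = ++-prefix D.u (lastLetters s) D'.u (lastLetters s') (trans (sym D.σ≡) D'.σ≡) (ℕP.<⇒≤ u'<u)
      rest = proj₁ prefixSplit
      u≡u'rest = proj₂ prefixSplit
      strictPrefix : ∀ e → D.u ≡ D'.u ++ e → ⊥
      strictPrefix []       eq = ℕP.<-irrefl (sym (trans (cong length eq) (trans (LP.length-++ D'.u) (ℕP.+-identityʳ _)))) u'<u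
      strictPrefix (y ∷ ys) eq = noEarlierHit D.u D'.u y ys j' D'.w eq D.initAvoids D'.u≡

    overlap-unique : ∀ j j' s s' σ → s < ℓ → s' < ℓ → T (Overlap j s σ) → T (Overlap j' s' σ) → (j ≡ j') × (s ≡ s')
    overlap-unique j j' s s' σ s<ℓ s'<ℓ t t' with ℕP.<-cmp s s'
    ... | tri< s<s' _ _ = ⊥-elim (overlap-earlier-absurd j j' s s' σ s<ℓ s'<ℓ s<s' t t')
    ... | tri> _ _ s'<s = ⊥-elim (overlap-earlier-absurd j' j s' s σ s'<ℓ s<ℓ s'<s t' t)
    ... | tri≈ _ refl _ = suffix-index-unique j j' D.w D'.w (trans (sym D.u≡) (trans u≡u' D'.u≡)) , refl
      where
      module D  = Decomposition (decompose j s σ t)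
      module D' = Decomposition (decompose j' s σ t')
      u≡u' : D.u ≡ D'.u
      u≡u' = ++-equal-length D.u (lastLetters s) D'.u (lastLetters s) (trans (sym D.σ≡) D'.σ≡)
               (ℕP.+-cancelʳ-≡ (length (lastLetters s)) (length D.u) (length D'.u)
                 (trans (sym (length-++-≡ D.u (lastLetters s) D.σ≡)) (length-++-≡ D'.u (lastLetters s) D'.σ≡)))

    -- If τ r = w S j and a = r ρ with r nonempty, then the overlap r of S j with a is
    -- recorded by the correlation bit of index |ρ|: r cannot contain S j, which would then
    -- be a proper factor of a, so r is a suffix of S j.
    overlapBit : ∀ j τ w r ρ → a ≡ r ++ ρ → τ ++ r ≡ w ++ S j → 1 ≤ length r → T (corrBit a (S j) (length ρ))
    overlapBit j τ w r ρ a≡ τr≡wS 1≤r with length r ℕP.≤? length (S j)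
    ... | yes r≤S =
      let (d , S≡dr) = ++-suffix τ r w (S j) τr≡wS r≤S in
      corrBit-complete a (S j) (length ρ) (subst (_≤ length (S j)) (sym overlapLength) r≤S)
        (trans takeIsR (sym (trans (cong₂ (λ x y → drop (x ∸ y) (S j)) (trans (cong length S≡dr) (LP.length-++ d)) overlapLength)
                            (trans (cong (λ z → drop z (S j)) (ℕP.m+n∸n≡m (length d) (length r)))
                                   (trans (cong (drop (length d)) S≡dr) (drop-++-length d r))))))
        (notProperFactor j)
      where
      overlapLength : ℓ ∸ length ρ ≡ length r
      overlapLength = trans (cong (λ z → length z ∸ length ρ) a≡)
                            (trans (cong (_∸ length ρ) (LP.length-++ r)) (ℕP.m+n∸n≡m (length r) (length ρ)))
      takeIsR : take (ℓ ∸ length ρ) a ≡ r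
      takeIsR = trans (cong₂ take overlapLength a≡) (take-++-length r ρ)
    ... | no r≰S =
      let (d , r≡dS) = ++-suffix w (S j) τ r (sym τr≡wS) (ℕP.<⇒≤ (ℕP.≰⇒> r≰S)) in
      ⊥-elim (notProperFactor j
                (ℕP.<-≤-trans (ℕP.≰⇒> r≰S) (subst (length r ≤_) (sym (trans (cong length a≡) (LP.length-++ r)))
                                                   (ℕP.m≤m+n (length r) (length ρ))))
                (subst (S j occursIn_) (sym a≡) (occurs-++ʳ (subst (S j occursIn_) (sym r≡dS) (occurs-suffix d (S j))) ρ)))

    cut : ∀ r ρ → a ≡ r ++ ρ → 1 ≤ length r → (length ρ < ℓ) × (lastLetters (length ρ) ≡ ρ)
    cut r ρ a≡rρ 1≤r =
      subst (length ρ <_) (sym ℓ≡) (ℕP.m<n+m (length ρ) 1≤r) ,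
      trans (cong₂ drop (trans (cong (_∸ length ρ) ℓ≡) (ℕP.m+n∸n≡m (length r) (length ρ))) a≡rρ)
            (drop-++-length r ρ)
      where
      ℓ≡ : ℓ ≡ length r ℕ.+ length ρ
      ℓ≡ = trans (cong length a≡rρ) (LP.length-++ r)

    -- Every word  τ a  with τ avoiding the family has an overlap decomposition: cut it just
    -- after the first letter completing a forbidden factor.
    endsWith⇒overlap : ∀ σ → T (endsWith a avoids σ) → Σ[ j ∈ Fin k ] Σ[ s ∈ ℕ ] (s < ℓ) × T (Overlap j s σ)
    endsWith⇒overlap σ t =
      j , s , proj₁ cutρ₂ , ∧-intro bit (∧-intro (proj₁ splitσ) (subst (λ z → T (firstHitBy j z)) (sym (proj₂ splitσ)) hit))
      where
      τ = stem a σ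
      σ≡τa : σ ≡ τ ++ a
      σ≡τa = hasSuffix-sound a σ (proj₁ (∧-elim (hasSuffix a σ) t))
      violation = firstViolation a τ (proj₂ (∧-elim (hasSuffix a σ) t))
                    (λ av → avoids-sound S (τ ++ a) av i (occurs-suffix τ a))
      ρ₁ = proj₁ violation
      y  = proj₁ (proj₂ violation)
      ρ₂ = proj₁ (proj₂ (proj₂ violation))
      avoids₁ : T (avoids (τ ++ ρ₁))
      avoids₁ = proj₁ (proj₂ (proj₂ (proj₂ (proj₂ violation))))
      occurrence = newOccurrence (τ ++ ρ₁) y avoids₁ (proj₂ (proj₂ (proj₂ (proj₂ (proj₂ violation)))))
      j = proj₁ occurrence
      w = proj₁ (proj₂ occurrence)
      r = ρ₁ ++ y ∷ []
      u = (τ ++ ρ₁) ++ y ∷ []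
      s = length ρ₂
      a≡rρ₂ : a ≡ r ++ ρ₂
      a≡rρ₂ = trans (proj₁ (proj₂ (proj₂ (proj₂ violation)))) (sym (LP.++-assoc ρ₁ (y ∷ []) ρ₂))
      1≤r : 1 ≤ length r
      1≤r = subst (1 ≤_) (sym (trans (LP.length-++ ρ₁) (ℕP.+-comm (length ρ₁) 1))) (s≤s z≤n)
      cutρ₂ = cut r ρ₂ a≡rρ₂ 1≤r
      u≡τr : u ≡ τ ++ r
      u≡τr = LP.++-assoc τ ρ₁ (y ∷ [])
      σ≡u++ : σ ≡ u ++ lastLetters s
      σ≡u++ = trans σ≡τa (trans (cong (τ ++_) a≡rρ₂) (trans (sym (LP.++-assoc τ r ρ₂))
                          (trans (cong (_++ ρ₂) (sym u≡τr)) (cong (u ++_) (sym (proj₂ cutρ₂))))))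
      splitσ = hasSuffix-complete (lastLetters s) σ u σ≡u++
      hit : T (firstHitBy j u)
      hit = firstHit-new (τ ++ ρ₁) y j w avoids₁ (proj₂ (proj₂ occurrence))
      bit : T (corrBit a (S j) s)
      bit = overlapBit j τ w r ρ₂ a≡rρ₂ (trans (sym u≡τr) (proj₂ (proj₂ occurrence))) 1≤r

    first-occurrence : ∀ σ →
      ΣFinℤ (λ j → Σ< ℓ (λ s → 𝟙 (corrBit a (S j) s) ℤ.* 𝟙 (endsWith (lastLetters s) (firstHitBy j) σ)))
        ≡ 𝟙 (endsWith a avoids σ)
    first-occurrence σ =
      trans (ΣFinℤ-cong (λ j → Σ<-cong ℓ (λ s → sym (𝟙-∧ (corrBit a (S j) s) (endsWith (lastLetters s) (firstHitBy j) σ)))))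
            (byCases (endsWith a avoids σ) refl)
      where
      byCases : ∀ b → endsWith a avoids σ ≡ b → ΣFinℤ (λ j → Σ< ℓ (λ s → 𝟙 (Overlap j s σ))) ≡ 𝟙 b
      byCases false eq =
        ΣFinℤ-0 _ (λ j → Σ<-0 ℓ (λ s s<ℓ → 𝟙-false (λ t → subst T eq (overlap⇒endsWith j s σ s<ℓ t))))
      byCases true eq =
        let (j₀ , s₀ , s₀<ℓ , t₀) = endsWith⇒overlap σ (subst T (sym eq) tt) in
        ΣFinℤ-unique _ j₀
          (Σ<-unique ℓ s₀ _ s₀<ℓ (𝟙-true t₀)
             (λ s s<ℓ s≢s₀ → 𝟙-false (λ t → s≢s₀ (proj₂ (overlap-unique j₀ j₀ s s₀ σ s<ℓ s₀<ℓ t t₀)))))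
          (λ j j≢j₀ → Σ<-0 ℓ (λ s s<ℓ → 𝟙-false (λ t → j≢j₀ (proj₁ (overlap-unique j j₀ s s₀ σ s<ℓ s₀<ℓ t t₀)))))

module LinearSystem {k} (S : Fin k → List ℕ) (nonempty : ∀ i → S i ≢ [])
                    (positive : ∀ i → All NonZero (S i)) (distinct : ∀ i j → i ≢ j → ¬ (S i occursIn S j)) where

  open FiniteSums
  open PowerSeries
  open WordSums
  open Factors
  open Correlation
  open Avoidance S distinct
  open Determinant using (ΣFin-*ˡ; unitColumn)
  open import Data.Nat as ℕ using (zero; suc; _∸_; _≤_; _<_; _≡ᵇ_; _≤ᵇ_)
  open import Data.Nat.Properties as ℕP using ()
  open import Data.Nat.ListAction using (sum)
  open import Data.Nat.ListAction.Properties using (sum-++)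
  open import Data.Integer using (ℤ; 0ℤ; 1ℤ; _+_; _*_; -_)
  open import Data.Integer.Properties as ℤP using ()
  open import Data.Integer.Tactic.RingSolver using (solve-∀)
  open import Data.List using (_∷_; _++_; length; map; upTo)
  open import Data.List.Relation.Unary.All as All using ()
  import Data.List.Relation.Unary.All.Properties as AllP
  import Data.List.Relation.Binary.Infix.Heterogeneous.Properties as InfixP
  open import Data.Fin using (zero; suc)
  open import Data.Bool using (Bool; true; false; _∧_; T)
  import Data.Bool as Bool
  open import Algebra.Bundles using (CommutativeRing; Ring)
  import Algebra.Properties.RingWithoutOne as RingWithoutOneProperties
  open import Relation.Binary.PropositionalEquality as P using (_≡_; refl)
  open import Relation.Nullary using (does)
  open import Relation.Nullary.Decidable using (_×-dec_)
  open import Data.Empty using (⊥-elim)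

  module R = CommutativeRing PSRing
  open RingWithoutOneProperties (Ring.ringWithoutOne R.ring) using (-‿distribˡ-*)

  G : PS
  G = countPS avoids

  H : Fin k → PS
  H j = countPS (firstHitBy j)

  GPS≈G : GPS S ≈PS G
  GPS≈G n m =
    P.trans (length-filter _ (listsOver m (map suc (upTo n))))
            (ΣList-cong (listsOver m (map suc (upTo n))) (λ σ → 𝟙-× (avoids σ) (sum σ) n))
    where
    𝟙-× : ∀ (b : Bool) x n → 𝟙 (does ((x ℕP.≟ n) ×-dec (b Bool.≟ true))) ≡ 𝟙 (x ≡ᵇ n) * 𝟙 b
    𝟙-× true  x n with x ≡ᵇ n
    ... | true  = refl
    ... | false = refl
    𝟙-× false x n with x ≡ᵇ n
    ... | true  = refl
    ... | false = refl

  positiveLetters : ∀ i → All (1 ≤_) (S i)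
  positiveLetters i = All.map (λ {x} nz → ℕ.>-nonZero⁻¹ x {{nz}}) (positive i)

  -- The overlap identity  Σ_j c_ij(x,q) H_j = x^{w(S_i)} q^{ℓ(S_i)} G, coefficientwise:
  -- expand each c_ij, turn each monomial times H_j into a count of words ending in the
  -- last s letters of S_i, and apply the first-occurrence identity.
  overlap-identity : ∀ i n m →
    ΣFinℤ (λ j → (corrPoly (S i) (S j) *PS H j) n m) ≡ (mono 1ℤ (sum (S i)) (length (S i)) *PS G) n m
  overlap-identity i n m =
    P.trans (ΣFinℤ-cong (λ j → P.trans (corrPolyFrom-*-coeff (S i) (S j) 0 ℓ (H j) n m)
                                        (Σ<-cong-< ℓ (λ s s<ℓ → P.cong (𝟙 (corrBit a (S j) s) *_) (asCount j s s<ℓ)))))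
    (P.trans (count-combination ℓ m n (λ j s → corrBit a (S j) s) (λ j s → endsWith (lastLetters s) (firstHitBy j)))
    (P.trans (ΣWords-cong m n (λ σ → P.cong (𝟙 (sum σ ≡ᵇ n) *_) (first-occurrence σ)))
             (count-endsWith (S i) avoids m n (positiveLetters i))))
    where
    open Overlaps i
    asCount : ∀ j s → s < ℓ → (corrMonomial a s *PS H j) n m ≡ count m n n (endsWith (lastLetters s) (firstHitBy j))
    asCount j s s<ℓ =
      P.sym (P.trans (count-endsWith (lastLetters s) (firstHitBy j) m n (AllP.drop⁺ (ℓ ∸ s) (positiveLetters i)))
                     (P.cong (λ z → (mono 1ℤ (sum (lastLetters s)) z *PS H j) n m) (length-lastLetters s s<ℓ)))

  overlapRow : ∀ i n m →
    (mono 1ℤ (sum (S i)) (length (S i)) *PS GPS S) n m + ΣFin (λ j → negCorrMatrix S i j *PS H j) n m ≡ 0ℤ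
  overlapRow i n m =
    P.trans (P.cong₂ _+_ (R.*-cong (R.refl {mono 1ℤ (sum (S i)) (length (S i))}) GPS≈G n m) negatedSum)
            (ℤP.+-inverseʳ ((mono 1ℤ (sum (S i)) (length (S i)) *PS G) n m))
    where
    negatedSum : ΣFin (λ j → negCorrMatrix S i j *PS H j) n m ≡ - (mono 1ℤ (sum (S i)) (length (S i)) *PS G) n m
    negatedSum =
      P.trans (ΣFin-coeff (λ j → negCorrMatrix S i j *PS H j) n m)
      (P.trans (ΣFinℤ-cong (λ j → P.sym (-‿distribˡ-* (corrPoly (S i) (S j)) (H j) n m)))
      (P.trans (ΣFinℤ-neg (λ j → (corrPoly (S i) (S j) *PS H j) n m))
               (P.cong -_ (overlap-identity i n m))))

  K : PS
  K = G +PS ΣFin H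

  K-as-count : ∀ n m →
    K n m ≡ ΣWords m n (λ σ → 𝟙 (sum σ ≡ᵇ n) * (𝟙 (avoids σ) + ΣFinℤ (λ j → 𝟙 (firstHitBy j σ))))
  K-as-count n m =
    P.trans (P.cong (G n m +_) (P.trans (ΣFin-coeff H n m)
                                        (P.sym (ΣWords-ΣFinℤ m n (λ j σ → 𝟙 (sum σ ≡ᵇ n) * 𝟙 (firstHitBy j σ))))))
    (P.trans (P.sym (ΣWords-+ m n _ _))
             (ΣWords-cong m n (λ σ →
                P.trans (P.cong (𝟙 (sum σ ≡ᵇ n) * 𝟙 (avoids σ) +_) (P.sym (ΣFinℤ-*ˡ (𝟙 (sum σ ≡ᵇ n)) (λ j → 𝟙 (firstHitBy j σ)))))
                        (P.sym (ℤP.*-distribˡ-+ (𝟙 (sum σ ≡ᵇ n)) (𝟙 (avoids σ)) _)))))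

  empty-avoids : T (avoids [])
  empty-avoids = avoids-complete S [] (λ j occ → nonempty j (emptyFactor (S j) (InfixP.length-mono occ)))
    where
    emptyFactor : ∀ (x : List ℕ) → length x ≤ 0 → x ≡ []
    emptyFactor [] _ = refl

  empty-notHit : ∀ j → firstHitBy j [] ≡ false
  empty-notHit j = notSuffix (S j) (nonempty j) _ _
    where
    notSuffix : ∀ (x : List ℕ) → x ≢ [] → ∀ b c → ((length x ≤ᵇ 0) ∧ b) ∧ c ≡ false
    notSuffix []      x≢[] b c = ⊥-elim (x≢[] refl)
    notSuffix (_ ∷ _) _    b c = refl

  K-empty : ∀ n → K n 0 ≡ 𝟙 (0 ≡ᵇ n)
  K-empty n =
    P.trans (K-as-count n 0)
    (P.trans (ΣWords-zero n (λ σ → 𝟙 (sum σ ≡ᵇ n) * (𝟙 (avoids σ) + ΣFinℤ (λ j → 𝟙 (firstHitBy j σ)))))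
    (P.trans (P.cong (λ z → 𝟙 (0 ≡ᵇ n) * (𝟙 (avoids []) + z)) (ΣFinℤ-0 _ (λ j → P.cong 𝟙 (empty-notHit j))))
    (P.trans (P.cong (λ z → 𝟙 (0 ≡ᵇ n) * (z + 0ℤ)) (𝟙-true empty-avoids))
             (ℤP.*-identityʳ (𝟙 (0 ≡ᵇ n))))))

  -- words of length m+1: by the append-letter identity, each avoiding word of length m and
  -- each last letter c+1 contributes once
  K-extend : ∀ n m → K n (suc m) ≡ Σ< n (λ c → G (n ∸ suc c) m)
  K-extend n m =
    P.trans (K-as-count n (suc m))
    (P.trans (P.cong (λ z → ΣWords z n weighted) (ℕP.+-comm 1 m))
    (P.trans (ΣWords-split m 1 n weighted)
    (P.trans (ΣWords-cong m n (λ τ → P.trans (ΣWords-suc 0 n (λ v → weighted (τ ++ v)))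
                                             (Σ<-cong-< n (λ c c<n → P.trans (ℤP.+-identityʳ _) (lastLetter τ c c<n)))))
    (P.trans (ΣWords-Σ< m n n (λ c τ → 𝟙 (sum τ ≡ᵇ n ∸ suc c) * 𝟙 (avoids τ)))
             (Σ<-cong-< n (λ c c<n → count-alphabet m n (n ∸ suc c) avoids (ℕP.m∸n≤m n (suc c))))))))
    where
    weighted : List ℕ → ℤ
    weighted σ = 𝟙 (sum σ ≡ᵇ n) * (𝟙 (avoids σ) + ΣFinℤ (λ j → 𝟙 (firstHitBy j σ)))
    lastLetter : ∀ τ c → c < n → weighted (τ ++ suc c ∷ []) ≡ 𝟙 (sum τ ≡ᵇ n ∸ suc c) * 𝟙 (avoids τ)
    lastLetter τ c c<n =
      P.cong₂ _*_ (P.cong 𝟙 (P.trans (P.cong (_≡ᵇ n) weight) (≡ᵇ-shift (suc c) (sum τ) n c<n)))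
                  (append-letter τ (suc c))
      where
      weight : sum (τ ++ suc c ∷ []) ≡ suc c ℕ.+ sum τ
      weight = P.trans (sum-++ τ (suc c ∷ []))
                       (P.trans (P.cong (sum τ ℕ.+_) (ℕP.+-identityʳ (suc c))) (ℕP.+-comm (sum τ) (suc c)))

  oneMinusX-K : ∀ n m → K n m + - (xPS *PS K) n m ≡ (1PS -PS xPS) n m + (xPS *PS (qPS *PS G)) n m
  oneMinusX-K zero zero
    rewrite x-shift-0 K 0 | x-shift-0 (qPS *PS G) 0 | K-empty 0 = refl
  oneMinusX-K (suc n) zero
    rewrite x-shift K n 0 | x-shift (qPS *PS G) n 0 | q-shift-0 G n | K-empty (suc n) | K-empty n = emptyWord n
    where
    emptyWord : ∀ n → 𝟙 (0 ≡ᵇ suc n) + - 𝟙 (0 ≡ᵇ n) ≡ (1PS -PS xPS) (suc n) 0 + 0ℤ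
    emptyWord zero    = refl
    emptyWord (suc n) = refl
  oneMinusX-K zero (suc m) =
    P.trans (P.cong₂ (λ x y → x + - y) (K-extend 0 m) (x-shift-0 K (suc m)))
            (P.sym (P.cong ((1PS -PS xPS) 0 (suc m) +_) (x-shift-0 (qPS *PS G) (suc m))))
  oneMinusX-K (suc n) (suc m)
    rewrite x-shift K n (suc m) | x-shift (qPS *PS G) n (suc m) | q-shift G n m
          | K-extend (suc n) m | K-extend n m | Σ<-suc n (λ c → G (suc n ∸ suc c) m) | x-coeff-q n m =
    P.trans (cancel (G n m) (Σ< n (λ c → G (n ∸ suc c) m))) (P.sym (ℤP.+-identityˡ (G n m)))
    where
    cancel : ∀ a b → (a + b) + - b ≡ a
    cancel = solve-∀

  1-x : PS
  1-x = 1PS -PS xPS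

  M00-split : (1PS -PS xPS *PS (1PS +PS qPS)) ≈PS (1-x -PS (xPS *PS qPS))
  M00-split n m =
    P.trans (P.cong (λ z → 1PS n m + - z)
                    (P.trans (R.distribˡ xPS 1PS qPS n m) (P.cong (_+ (xPS *PS qPS) n m) (R.*-identityʳ xPS n m))))
            (regroup (1PS n m) (xPS n m) ((xPS *PS qPS) n m))
    where regroup : ∀ a b c → a + - (b + c) ≡ (a + - b) + - c
          regroup = solve-∀

  firstRow : ∀ n m →
    (Mmatrix S zero zero *PS GPS S) n m + ΣFin (λ j → Mmatrix S zero (suc j) *PS H j) n m ≡ 1-x n m
  firstRow n m =
    P.trans (P.cong₂ _+_ avoidingPart hitPart)
            (rearrange ((1-x *PS G) n m) ((xPS *PS (qPS *PS G)) n m) ((1-x *PS ΣFin H) n m) (1-x n m)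
              (P.trans (P.sym (R.distribˡ 1-x G (ΣFin H) n m)) (P.trans oneMinusX-times-K (oneMinusX-K n m))))
    where
    avoidingPart : (Mmatrix S zero zero *PS GPS S) n m ≡ (1-x *PS G) n m + - (xPS *PS (qPS *PS G)) n m
    avoidingPart =
      R.trans (R.*-cong M00-split GPS≈G)
      (R.trans (R.distribʳ G 1-x (-PS (xPS *PS qPS)))
               (R.+-cong (R.refl {1-x *PS G})
                         (R.trans (R.sym (-‿distribˡ-* (xPS *PS qPS) G)) (R.-‿cong (R.*-assoc xPS qPS G))))) n m
    hitPart : ΣFin (λ j → 1-x *PS H j) n m ≡ (1-x *PS ΣFin H) n m
    hitPart = P.sym (ΣFin-*ˡ 1-x H n m)
    oneMinusX-times-K : (1-x *PS K) n m ≡ K n m + - (xPS *PS K) n m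
    oneMinusX-times-K =
      P.trans (R.distribʳ K 1PS (-PS xPS) n m)
              (P.cong₂ _+_ (R.*-identityˡ K n m) (P.sym (-‿distribˡ-* xPS K n m)))
    rearrange : ∀ a b c d → a + c ≡ d + b → (a + - b) + c ≡ d
    rearrange a b c d a+c≡d+b = P.trans (swap a b c) (P.trans (P.cong (_+ - b) a+c≡d+b) (cancel d b))
      where swap : ∀ a b c → (a + - b) + c ≡ (a + c) + - b
            swap = solve-∀
            cancel : ∀ d b → (d + b) + - b ≡ d
            cancel = solve-∀

  unknowns : Fin (suc k) → PS
  unknowns zero    = GPS S
  unknowns (suc j) = H j

  system : ∀ r → ΣFin (λ j → Mmatrix S r j *PS unknowns j) ≈PS unitColumn 1-x r
  system zero    = firstRow
  system (suc i) = overlapRow i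

open PowerSeries using (PSRing)
open Determinant using (cramer-column0; det-column0-unit; withColumn0; unitColumn)
open import Algebra.Bundles using (CommutativeRing)
import Relation.Binary.Reasoning.Setoid as SetoidReasoning

-- Cramer's rule applied to the linear system of LinearSystem; the lower-right block of M
-- is the matrix (−c_ij), and k ≥ 1 makes M at least 2 × 2 as det-column0-unit requires.
theorem2 : (k : ℕ) → 1 ≤ k → (S : Fin k → List ℕ)
    → (∀ i → S i ≢ [])
    → (∀ i → All NonZero (S i))
    → (∀ i j → i ≢ j → ¬ (S i occursIn S j))
    → (GPS S *PS det (Mmatrix S)) ≈PS ((1PS -PS xPS) *PS det (negCorrMatrix S))
theorem2 (suc k) _ S nonempty positive distinct =
  begin
    GPS S *PS det (Mmatrix S)
  ≈⟨ R.*-comm (GPS S) (det (Mmatrix S)) ⟩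
    det (Mmatrix S) *PS GPS S
  ≈⟨ cramer-column0 (Mmatrix S) unknowns (unitColumn 1-x) system ⟩
    det (withColumn0 (Mmatrix S) (unitColumn 1-x))
  ≈⟨ det-column0-unit (Mmatrix S) 1-x ⟩
    (1PS -PS xPS) *PS det (negCorrMatrix S)
  ∎
  where
  module R = CommutativeRing PSRing
  open SetoidReasoning R.setoid
  open LinearSystem S nonempty positive distinct using (unknowns; 1-x; system)
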